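{- For $n\geq 3$, the system of recurrences below has a unique solution $(tri(n),sq(n),ast(n),dia(n),St1(n),St2(n),St(n),t(n),p(n))$, and the number of sets $\{x_1,\dots,x_n\}$ of $n$ pairwise distinct positive integers, each of the form $2^{a}3^{b}$ with $a\in\{0,1,2\}$, $b\geq 0$, satisfying $\sum_{i=1}^n 1/x_i=1$, equals $$tri(n)+sq(n)+ast(n)+dia(n)+St1(n)+St2(n)+St(n).$$
   Context: Let $\delta_{n=k}$ equal $1$ if $n=k$ and $0$ otherwise. The sequences are indexed by $n\geq 3$, with initial values $tri(3)=1$ and $dia(3)=sq(3)=ast(3)=St(3)=St2(3)=St1(3)=t(3)=p(3)=dia(4)=St(4)=St2(4)=St1(4)=t(4)=p(4)=St(5)=St2(5)=St1(5)=St2(6)=St(6)=St2(7)=St(7)=0$, and recurrences (for every $n$ whose value is not fixed by an initial value): $ast(n)=ast(n-1)+dia(n-1)+\delta_{n=4}$; $tri(n)=tri(n-1)+sq(n-1)+St1(n-1)+St2(n-1)+St(n-1)$; $sq(n)=ast(n-1)+dia(n-1)$; $dia(n)=tri(n-2)+sq(n-2)+St1(n-2)+St2(n-2)+St(n-2)$; $St1(n)=ast(n-3)+dia(n-3)+\delta_{n=6}$; $St2(n)=ast(n-5)+dia(n-5)+t(n-5)+p(n-5)+\delta_{n=8}$; $St(n)=tri(n-5)+sq(n-5)+St1(n-5)+St2(n-5)+St(n-5)$; $t(n)=ast(n-2)+dia(n-2)+t(n-2)+p(n-2)+\delta_{n=5}$; $p(n)=tri(n-2)+sq(n-2)+St1(n-2)+St2(n-2)+St(n-2)$.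 Solutions are counted as unordered sets. -}

module Defs where

open import Data.Nat using (ℕ; zero; suc; _+_; _*_; _∸_; _^_; _≤_; _<_; _≡ᵇ_)
open import Data.Bool using (if_then_else_)
open import Data.Integer using (+_)
open import Data.Rational as ℚ using (ℚ; 0ℚ; 1ℚ)
open import Data.List using (List; length; map; foldr)
open import Data.List.Relation.Unary.All using (All)
open import Data.List.Relation.Unary.Linked using (Linked)
open import Data.Product using (Σ; ∃; _×_)
open import Relation.Binary.PropositionalEquality using (_≡_)

δ : ℕ → ℕ → ℕ
δ n k = if n ≡ᵇ k then 1 else 0

record Seqs : Set where
  field
    tri sq ast dia St1 St2 St t p : ℕ → ℕ
open Seqs public

-- The recurrence / initial-value equation for each sequence at index n
-- (only imposed for n ≥ 3; initial values take precedence over the recurrence).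

triEq : Seqs → ℕ → Set
triEq s 3 = tri s 3 ≡ 1
triEq s n = tri s n ≡ tri s (n ∸ 1) + sq s (n ∸ 1) + St1 s (n ∸ 1) + St2 s (n ∸ 1) + St s (n ∸ 1)

sqEq : Seqs → ℕ → Set
sqEq s 3 = sq s 3 ≡ 0
sqEq s n = sq s n ≡ ast s (n ∸ 1) + dia s (n ∸ 1)

astEq : Seqs → ℕ → Set
astEq s 3 = ast s 3 ≡ 0
astEq s n = ast s n ≡ ast s (n ∸ 1) + dia s (n ∸ 1) + δ n 4

diaEq : Seqs → ℕ → Set
diaEq s 3 = dia s 3 ≡ 0
diaEq s 4 = dia s 4 ≡ 0
diaEq s n = dia s n ≡ tri s (n ∸ 2) + sq s (n ∸ 2) + St1 s (n ∸ 2) + St2 s (n ∸ 2) + St s (n ∸ 2)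

St1Eq : Seqs → ℕ → Set
St1Eq s 3 = St1 s 3 ≡ 0
St1Eq s 4 = St1 s 4 ≡ 0
St1Eq s 5 = St1 s 5 ≡ 0
St1Eq s n = St1 s n ≡ ast s (n ∸ 3) + dia s (n ∸ 3) + δ n 6

St2Eq : Seqs → ℕ → Set
St2Eq s 3 = St2 s 3 ≡ 0
St2Eq s 4 = St2 s 4 ≡ 0
St2Eq s 5 = St2 s 5 ≡ 0
St2Eq s 6 = St2 s 6 ≡ 0
St2Eq s 7 = St2 s 7 ≡ 0
St2Eq s n = St2 s n ≡ ast s (n ∸ 5) + dia s (n ∸ 5) + t s (n ∸ 5) + p s (n ∸ 5) + δ n 8

StEq : Seqs → ℕ → Set
StEq s 3 = St s 3 ≡ 0
StEq s 4 = St s 4 ≡ 0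
StEq s 5 = St s 5 ≡ 0
StEq s 6 = St s 6 ≡ 0
StEq s 7 = St s 7 ≡ 0
StEq s n = St s n ≡ tri s (n ∸ 5) + sq s (n ∸ 5) + St1 s (n ∸ 5) + St2 s (n ∸ 5) + St s (n ∸ 5)

tEq : Seqs → ℕ → Set
tEq s 3 = t s 3 ≡ 0
tEq s 4 = t s 4 ≡ 0
tEq s n = t s n ≡ ast s (n ∸ 2) + dia s (n ∸ 2) + t s (n ∸ 2) + p s (n ∸ 2) + δ n 5

pEq : Seqs → ℕ → Set
pEq s 3 = p s 3 ≡ 0
pEq s 4 = p s 4 ≡ 0
pEq s n = p s n ≡ tri s (n ∸ 2) + sq s (n ∸ 2) + St1 s (n ∸ 2) + St2 s (n ∸ 2) + St s (n ∸ 2)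

IsSolution : Seqs → Set
IsSolution s = ∀ n → 3 ≤ n →
  triEq s n × sqEq s n × astEq s n × diaEq s n × St1Eq s n ×
  St2Eq s n × StEq s n × tEq s n × pEq s n

SameOn≥3 : Seqs → Seqs → Set
SameOn≥3 s s' = ∀ n → 3 ≤ n →
  (tri s n ≡ tri s' n) × (sq s n ≡ sq s' n) × (ast s n ≡ ast s' n) ×
  (dia s n ≡ dia s' n) × (St1 s n ≡ St1 s' n) × (St2 s n ≡ St2 s' n) ×
  (St s n ≡ St s' n) × (t s n ≡ t s' n) × (p s n ≡ p s' n)

total : Seqs → ℕ → ℕ
total s n = tri s n + sq s n + ast s n + dia s n + St1 s n + St2 s n + St s n

Form23 : ℕ → Set
Form23 x = Σ ℕ λ a → Σ ℕ λ b → (a ≤ 2) × (x ≡ 2 ^ a * 3 ^ b)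

-- reciprocal 1/x as a rational (x = 0 never occurs for admissible x)
recip : ℕ → ℚ
recip zero = 0ℚ
recip (suc k) = (+ 1) ℚ./ suc k

sumRecip : List ℕ → ℚ
sumRecip xs = foldr (λ x r → recip x ℚ.+ r) 0ℚ xs

-- A set {x_1,…,x_n} of n pairwise distinct positive integers, represented
-- canonically as the strictly increasing list of its elements.
Admissible : ℕ → List ℕ → Set
Admissible n xs =
  (length xs ≡ n) × Linked _<_ xs × (All (λ x → 0 < x) xs) ×
  All Form23 xs × (sumRecip xs ≡ 1ℚ)

module Submission where

-- An admissible set X splits uniquely as X = S ∪ 3·Y, where S = X ∖ 3ℕ ⊆ {1, 2, 4} and Y is again a set of
-- numbers 2^a 3^b with a ≤ 2.  Measuring reciprocal sums in quarters, Σ_X 1/x = t/4 becomes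
-- Σ_Y 1/y = 3 (t − w)/4 with w = Σ_S 4/s.  As every such sum is at most (7/4)(1 + 1/3 + 1/9 + ⋯) = 21/8,
-- only t − w ≤ 3 can occur, so the sets of size n and sum t/4 are produced by a finite recursion, and the
-- same recursion computed in ℕ counts them.  Unfolding it, the number h(n) of sets of size n with sum 3/2
-- satisfies h(k + 4) + h(k) = h(k + 3) + 2 h(k + 2), and there are 2 h(n − 1) sets with sum 1.  Eliminating
-- the auxiliary sums of the paper's system shows that the total satisfies the same recurrence, and the two
-- sequences agree on their initial values.

module Solution where

  open import Defs
  open import Data.Nat using (ℕ; zero; suc; _+_; _≤_; z≤n; s≤s)
  open import Data.Product using (_×_; _,_; proj₁)
  open import Relation.Binary.PropositionalEquality using (_≡_; refl; sym; trans; cong)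

  triSum astSum tpSum : Seqs → ℕ → ℕ
  triSum s n = tri s n + sq s n + St1 s n + St2 s n + St s n
  astSum s n = ast s n + dia s n
  tpSum s n = ast s n + dia s n + t s n + p s n

  -- The values below index 3 are never constrained; they are set to 0.
  mutual
    Tri Sq Ast Dia ST1 ST2 ST T P : ℕ → ℕ
    Tri 3 = 1
    Tri (suc n@(suc (suc (suc _)))) = Tri n + Sq n + ST1 n + ST2 n + ST n
    Tri _ = 0

    Sq (suc n@(suc (suc (suc _)))) = Ast n + Dia n
    Sq _ = 0

    Ast (suc n@(suc (suc (suc _)))) = Ast n + Dia n + δ (suc n) 4
    Ast _ = 0

    Dia (suc (suc n@(suc (suc (suc _))))) = Tri n + Sq n + ST1 n + ST2 n + ST n
    Dia _ = 0

    ST1 (suc (suc (suc n@(suc (suc (suc _)))))) = Ast n + Dia n + δ (3 + n) 6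
    ST1 _ = 0

    ST2 (suc (suc (suc (suc (suc n@(suc (suc (suc _)))))))) = Ast n + Dia n + T n + P n + δ (5 + n) 8
    ST2 _ = 0

    ST (suc (suc (suc (suc (suc n@(suc (suc (suc _)))))))) = Tri n + Sq n + ST1 n + ST2 n + ST n
    ST _ = 0

    T (suc (suc n@(suc (suc (suc _))))) = Ast n + Dia n + T n + P n + δ (2 + n) 5
    T _ = 0

    P (suc (suc n@(suc (suc (suc _))))) = Tri n + Sq n + ST1 n + ST2 n + ST n
    P _ = 0

  solution : Seqs
  solution = record
    { tri = Tri ; sq = Sq ; ast = Ast ; dia = Dia ; St1 = ST1 ; St2 = ST2 ; St = ST ; t = T ; p = P }

  solution-isSolution : IsSolution solution
  solution-isSolution 3 _ = refl , refl , refl , refl , refl , refl , refl , refl , refl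
  solution-isSolution 4 _ = refl , refl , refl , refl , refl , refl , refl , refl , refl
  solution-isSolution 5 _ = refl , refl , refl , refl , refl , refl , refl , refl , refl
  solution-isSolution 6 _ = refl , refl , refl , refl , refl , refl , refl , refl , refl
  solution-isSolution 7 _ = refl , refl , refl , refl , refl , refl , refl , refl , refl
  solution-isSolution (suc (suc (suc (suc (suc (suc (suc (suc _)))))))) _ =
    refl , refl , refl , refl , refl , refl , refl , refl , refl
  solution-isSolution 1 (s≤s ())
  solution-isSolution 2 (s≤s (s≤s ()))

  module Agreement (s s′ : Seqs) where

    AgreeAt : ℕ → Set
    AgreeAt n = (tri s n ≡ tri s′ n) × (sq s n ≡ sq s′ n) × (ast s n ≡ ast s′ n) ×
      (dia s n ≡ dia s′ n) × (St1 s n ≡ St1 s′ n) × (St2 s n ≡ St2 s′ n) ×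
      (St s n ≡ St s′ n) × (t s n ≡ t s′ n) × (p s n ≡ p s′ n)

    triSum-agree : ∀ {n} → AgreeAt n → triSum s n ≡ triSum s′ n
    triSum-agree (a , b , _ , _ , e , f , g , _ , _) rewrite a | b | e | f | g = refl

    astSum-agree : ∀ {n} → AgreeAt n → astSum s n ≡ astSum s′ n
    astSum-agree (_ , _ , c , d , _ , _ , _ , _ , _) rewrite c | d = refl

    tpSum-agree : ∀ {n} → AgreeAt n → tpSum s n ≡ tpSum s′ n
    tpSum-agree (_ , _ , c , d , _ , _ , _ , h , i) rewrite c | d | h | i = refl

  module Uniqueness (s′ : Seqs) (s′-isSolution : IsSolution s′) where

    open Agreement solution s′ renaming (AgreeAt to Agree)

    3≤3+ : ∀ {k} → 3 ≤ 3 + k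
    3≤3+ = s≤s (s≤s (s≤s z≤n))

    _∙+_ : ∀ {a b} → a ≡ b → (c : ℕ) → a + c ≡ b + c
    e ∙+ c = cong (_+ c) e

    -- The recurrences reach back at most five indices.
    Window : ℕ → Set
    Window k = Agree (3 + k) × Agree (4 + k) × Agree (5 + k) × Agree (6 + k) × Agree (7 + k)

    initial-window : Window 0
    initial-window = a3 , a4 , a5 , a6 , a7
      where
      a3 : Agree 3
      a3 with s′-isSolution 3 3≤3+
      ... | a , b , c , d , e , f , g , h , i =
        sym a , sym b , sym c , sym d , sym e , sym f , sym g , sym h , sym i
      a4 : Agree 4
      a4 with s′-isSolution 4 3≤3+
      ... | a , b , c , d , e , f , g , h , i =
        trans (triSum-agree a3) (sym a) , trans (astSum-agree a3) (sym b) ,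
        trans (astSum-agree a3 ∙+ 1) (sym c) , sym d , sym e , sym f , sym g , sym h , sym i
      a5 : Agree 5
      a5 with s′-isSolution 5 3≤3+
      ... | a , b , c , d , e , f , g , h , i =
        trans (triSum-agree a4) (sym a) , trans (astSum-agree a4) (sym b) ,
        trans (astSum-agree a4 ∙+ 0) (sym c) , trans (triSum-agree a3) (sym d) , sym e , sym f , sym g ,
        trans (tpSum-agree a3 ∙+ 1) (sym h) , trans (triSum-agree a3) (sym i)
      a6 : Agree 6
      a6 with s′-isSolution 6 3≤3+
      ... | a , b , c , d , e , f , g , h , i =
        trans (triSum-agree a5) (sym a) , trans (astSum-agree a5) (sym b) ,
        trans (astSum-agree a5 ∙+ 0) (sym c) , trans (triSum-agree a4) (sym d) ,
        trans (astSum-agree a3 ∙+ 1) (sym e) , sym f , sym g ,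
        trans (tpSum-agree a4 ∙+ 0) (sym h) , trans (triSum-agree a4) (sym i)
      a7 : Agree 7
      a7 with s′-isSolution 7 3≤3+
      ... | a , b , c , d , e , f , g , h , i =
        trans (triSum-agree a6) (sym a) , trans (astSum-agree a6) (sym b) ,
        trans (astSum-agree a6 ∙+ 0) (sym c) , trans (triSum-agree a5) (sym d) ,
        trans (astSum-agree a4 ∙+ 0) (sym e) , sym f , sym g ,
        trans (tpSum-agree a5 ∙+ 0) (sym h) , trans (triSum-agree a5) (sym i)

    window : ∀ k → Window k
    window zero = initial-window
    window (suc k) with window k
    ... | a3 , a4 , a5 , a6 , a7 = a4 , a5 , a6 , a7 , a8
      where
      a8 : Agree (8 + k)
      a8 with s′-isSolution (8 + k) 3≤3+
      ... | a , b , c , d , e , f , g , h , i =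
        trans (triSum-agree a7) (sym a) , trans (astSum-agree a7) (sym b) ,
        trans (astSum-agree a7 ∙+ _) (sym c) , trans (triSum-agree a6) (sym d) ,
        trans (astSum-agree a5 ∙+ _) (sym e) , trans (tpSum-agree a3 ∙+ _) (sym f) ,
        trans (triSum-agree a3) (sym g) , trans (tpSum-agree a6 ∙+ _) (sym h) , trans (triSum-agree a6) (sym i)

  solution-unique : ∀ s′ → IsSolution s′ → SameOn≥3 solution s′
  solution-unique s′ s′-isSolution (suc (suc (suc k))) _ = proj₁ (Uniqueness.window s′ s′-isSolution k)
  solution-unique _ _ 1 (s≤s ())
  solution-unique _ _ 2 (s≤s (s≤s ()))

module Enumeration where

  open import Data.Bool as Bool using (Bool; true; false; _∧_; if_then_else_)
  open import Data.Bool.ListAction using (any)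
  open import Data.List using (List; []; _∷_; _++_; map; length)
  open import Data.List.Membership.Propositional using (_∈_)
  open import Data.List.Membership.Propositional.Properties using (∈-map⁻; ∈-++⁻)
  open import Data.List.Relation.Unary.AllPairs using ([]; _∷_)
  import Data.List.Relation.Unary.All as All
  open import Data.List.Relation.Unary.All.Properties using (All¬⇒¬Any)
  open import Data.List.Relation.Unary.Any using (here; there)
  open import Data.List.Relation.Unary.Unique.Propositional using (Unique)
  open import Data.List.Relation.Unary.Unique.Propositional.Properties using (map⁺; ++⁺)
  open import Data.List.Relation.Unary.Unique.DecPropositional using (unique?)
  open import Data.List.Properties using (length-++; length-map; map-injective; ∷-injectiveʳ)
  open import Data.Nat using (ℕ; zero; suc; _+_; _*_; _∸_; _≤ᵇ_; _≡ᵇ_)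
  open import Data.Nat.Properties using (*-cancelˡ-≡; *-distribˡ-+)
  open import Data.Product using (_×_; _,_)
  open import Data.Product.Properties using (≡-dec)
  open import Data.Sum using (inj₁; inj₂)
  open import Relation.Nullary using (¬_)
  open import Relation.Nullary.Decidable using (toWitness)
  open import Function using (_∘_)
  open import Relation.Binary.PropositionalEquality using (_≡_; refl; sym; cong; cong₂; trans)

  -- A subset S of {1, 2, 4}, as (1 ∈ S , 2 ∈ S , 4 ∈ S).
  Sub124 : Set
  Sub124 = Bool × Bool × Bool

  sub124s : List Sub124
  sub124s = (false , false , false) ∷ (false , false , true) ∷ (false , true , false) ∷ (false , true , true) ∷
            (true , false , false) ∷ (true , false , true) ∷ (true , true , false) ∷ (true , true , true) ∷ []

  count𝔹 : Bool → ℕ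
  count𝔹 true = 1
  count𝔹 false = 0

  -- Σ_{x ∈ S} 1/x, in quarters.
  weight : Sub124 → ℕ
  weight (b₁ , b₂ , b₄) = 4 * count𝔹 b₁ + 2 * count𝔹 b₂ + count𝔹 b₄

  size : Sub124 → ℕ
  size (b₁ , b₂ , b₄) = count𝔹 b₁ + count𝔹 b₂ + count𝔹 b₄

  -- Y must have reciprocal sum 3 (t ∸ weight S) / 4, and no such sum reaches 3 (see maxSum).
  fits : Sub124 → ℕ → Bool
  fits S t = (weight S ≤ᵇ t) ∧ (t ∸ weight S ≤ᵇ 3)

  triple : List ℕ → List ℕ
  triple = map (3 *_)

  consIf : Bool → ℕ → List ℕ → List ℕ
  consIf true x zs = x ∷ zs
  consIf false x zs = zs

  -- Inserts 4 into the increasing list 3·ys, i.e. after 3 = 3·1 if present.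
  with4 : Bool → List ℕ → List ℕ
  with4 false ys = triple ys
  with4 true (1 ∷ ys) = 3 ∷ 4 ∷ triple ys
  with4 true ys = 4 ∷ triple ys

  extend : Sub124 → List ℕ → List ℕ
  extend (b₁ , b₂ , b₄) ys = consIf b₁ 1 (consIf b₂ 2 (with4 b₄ ys))

  -- sets n t lists the sets of size n with reciprocal sum t/4, peeling off S = X ∖ 3ℕ from X = S ∪ 3·Y;
  -- instantiated at ℕ the same recursion counts them.
  module Enumerate {A : Set} (∅ unit : A) (_∪_ : A → A → A) (image : Sub124 → A → A) where

    mutual
      level : (ℕ → ℕ → A) → ℕ → ℕ → A
      level prev f zero = ∅
      level prev f (suc t) = branches prev f (suc t) sub124s

      branches : (ℕ → ℕ → A) → ℕ → ℕ → List Sub124 → A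
      branches prev f t [] = ∅
      branches prev f t (S ∷ Ss) = branch prev f t S ∪ branches prev f t Ss

      branch : (ℕ → ℕ → A) → ℕ → ℕ → Sub124 → A
      branch prev f t S = if fits S t then image S (rest prev f (size S) (3 * (t ∸ weight S))) else ∅

      rest : (ℕ → ℕ → A) → ℕ → ℕ → ℕ → A
      rest prev f (suc p) t = prev p t
      rest prev zero zero t = ∅
      rest prev (suc f) zero t = level prev f t

    -- sets∸ n p t = sets (n ∸ p) t, arranged so that the recursion on n is structural.  The fuel 2 bounds
    -- consecutive steps with S = ∅, which keep the size, need t ≤ 3 and multiply t by 3.
    sets∸ : ℕ → ℕ → ℕ → A
    sets∸ zero zero zero = unit
    sets∸ zero zero (suc _) = ∅
    sets∸ zero (suc p) t = ∅
    sets∸ (suc n) zero t = level (sets∸ n) 2 t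
    sets∸ (suc n) (suc p) t = sets∸ n p t

    sets : ℕ → ℕ → A
    sets n = sets∸ n 0

  open Enumerate [] ([] ∷ []) _++_ (map ∘ extend) public
  open module Count = Enumerate 0 1 _+_ (λ _ n → n) public using () renaming (sets∸ to count∸; sets to count)

  mutual
    length-level : ∀ {prev cprev} → (∀ p t → length (prev p t) ≡ cprev p t) →
                   ∀ f t → length (level prev f t) ≡ Count.level cprev f t
    length-level hyp f zero = refl
    length-level hyp f (suc t) = length-branches hyp f (suc t) sub124s

    length-branches : ∀ {prev cprev} → (∀ p t → length (prev p t) ≡ cprev p t) →
                      ∀ f t Ss → length (branches prev f t Ss) ≡ Count.branches cprev f t Ss
    length-branches hyp f t [] = refl
    length-branches {prev} hyp f t (S ∷ Ss) =
      trans (length-++ (branch prev f t S)) (cong₂ _+_ (length-branch hyp f t S) (length-branches hyp f t Ss))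

    length-branch : ∀ {prev cprev} → (∀ p t → length (prev p t) ≡ cprev p t) →
                    ∀ f t S → length (branch prev f t S) ≡ Count.branch cprev f t S
    length-branch {prev} hyp f t S with fits S t
    ... | true = trans (length-map (extend S) (rest prev f (size S) _)) (length-rest hyp f (size S) _)
    ... | false = refl

    length-rest : ∀ {prev cprev} → (∀ p t → length (prev p t) ≡ cprev p t) →
                  ∀ f p t → length (rest prev f p t) ≡ Count.rest cprev f p t
    length-rest hyp f (suc p) t = hyp p t
    length-rest hyp zero zero t = refl
    length-rest hyp (suc f) zero t = length-level hyp f t

  length-sets∸ : ∀ n p t → length (sets∸ n p t) ≡ count∸ n p t
  length-sets∸ zero zero zero = refl
  length-sets∸ zero zero (suc t) = refl
  length-sets∸ zero (suc p) t = refl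
  length-sets∸ (suc n) zero t = length-level (length-sets∸ n) 2 t
  length-sets∸ (suc n) (suc p) t = length-sets∸ n p t

  length-sets : ∀ n t → length (sets n t) ≡ count n t
  length-sets n = length-sets∸ n 0

  has : ℕ → List ℕ → Bool
  has k = any (k ≡ᵇ_)

  -- key recovers S from extend S ys, so the branches of a level are disjoint.
  key : List ℕ → Sub124
  key xs = has 1 xs , has 2 xs , has 4 xs

  1,2,4≢3* : ∀ y → ((1 ≡ᵇ 3 * y) ≡ false) × ((2 ≡ᵇ 3 * y) ≡ false) × ((4 ≡ᵇ 3 * y) ≡ false)
  1,2,4≢3* 0 = refl , refl , refl
  1,2,4≢3* 1 = refl , refl , refl
  1,2,4≢3* 2 = refl , refl , refl
  1,2,4≢3* 3 = refl , refl , refl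
  1,2,4≢3* (suc (suc (suc (suc z)))) = cong (1 ≡ᵇ_) 3*4+z , cong (2 ≡ᵇ_) 3*4+z , cong (4 ≡ᵇ_) 3*4+z
    where 3*4+z = *-distribˡ-+ 3 4 z

  HasKey : List ℕ → Sub124 → Set
  HasKey xs (b₁ , b₂ , b₄) = (has 1 xs ≡ b₁) × (has 2 xs ≡ b₂) × (has 4 xs ≡ b₄)

  triple-hasKey : ∀ ys → HasKey (triple ys) (false , false , false)
  triple-hasKey [] = refl , refl , refl
  triple-hasKey (y ∷ ys) with 1,2,4≢3* y | triple-hasKey ys
  ... | e₁ , e₂ , e₄ | e₁′ , e₂′ , e₄′ rewrite e₁ | e₂ | e₄ = e₁′ , e₂′ , e₄′

  with4-hasKey : ∀ b ys → HasKey (with4 b ys) (false , false , b)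
  with4-hasKey false ys = triple-hasKey ys
  with4-hasKey true [] = refl , refl , refl
  with4-hasKey true (0 ∷ ys) with triple-hasKey ys
  ... | e₁ , e₂ , _ rewrite e₁ | e₂ = refl , refl , refl
  with4-hasKey true (1 ∷ ys) with triple-hasKey ys
  ... | e₁ , e₂ , _ rewrite e₁ | e₂ = refl , refl , refl
  with4-hasKey true (y@(suc (suc _)) ∷ ys) with 1,2,4≢3* y | triple-hasKey ys
  ... | e₁ , e₂ , _ | e₁′ , e₂′ , _ rewrite e₁ | e₂ | e₁′ | e₂′ = refl , refl , refl

  key-extend : ∀ S ys → key (extend S ys) ≡ S
  key-extend (b₁ , b₂ , b₄) ys with with4-hasKey b₄ ys
  key-extend (true , true , b₄) ys | _ , _ , e₄ rewrite e₄ = refl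
  key-extend (true , false , b₄) ys | _ , e₂ , e₄ rewrite e₂ | e₄ = refl
  key-extend (false , true , b₄) ys | e₁ , _ , e₄ rewrite e₁ | e₄ = refl
  key-extend (false , false , b₄) ys | e₁ , e₂ , e₄ rewrite e₁ | e₂ | e₄ = refl

  triple-injective : ∀ {xs ys} → triple xs ≡ triple ys → xs ≡ ys
  triple-injective = map-injective (*-cancelˡ-≡ _ _ 3)

  remove4 : List ℕ → List ℕ
  remove4 [] = []
  remove4 (x ∷ xs) = if 4 ≡ᵇ x then remove4 xs else x ∷ remove4 xs

  remove4-triple : ∀ ys → remove4 (triple ys) ≡ triple ys
  remove4-triple [] = refl
  remove4-triple (y ∷ ys) with 1,2,4≢3* y
  ... | _ , _ , e₄ rewrite e₄ = cong (3 * y ∷_) (remove4-triple ys)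

  remove4-with4 : ∀ b ys → remove4 (with4 b ys) ≡ triple ys
  remove4-with4 false ys = remove4-triple ys
  remove4-with4 true [] = refl
  remove4-with4 true (0 ∷ ys) = cong (0 ∷_) (remove4-triple ys)
  remove4-with4 true (1 ∷ ys) = cong (3 ∷_) (remove4-triple ys)
  remove4-with4 true (suc (suc y) ∷ ys) = remove4-triple (suc (suc y) ∷ ys)

  with4-injective : ∀ b {xs ys} → with4 b xs ≡ with4 b ys → xs ≡ ys
  with4-injective b {xs} {ys} e =
    triple-injective (trans (sym (remove4-with4 b xs)) (trans (cong remove4 e) (remove4-with4 b ys)))

  consIf-injective : ∀ b x {xs ys} → consIf b x xs ≡ consIf b x ys → xs ≡ ys
  consIf-injective true x e = ∷-injectiveʳ e
  consIf-injective false x e = e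

  extend-injective : ∀ S {xs ys} → extend S xs ≡ extend S ys → xs ≡ ys
  extend-injective (b₁ , b₂ , b₄) e = with4-injective b₄ (consIf-injective b₂ 2 (consIf-injective b₁ 1 e))

  sub124s-unique : Unique sub124s
  sub124s-unique = toWitness {a? = unique? (≡-dec Bool._≟_ (≡-dec Bool._≟_ Bool._≟_)) sub124s} _

  module _ {prev : ℕ → ℕ → List (List ℕ)} (prev-unique : ∀ p t → Unique (prev p t)) where

    key-branch : ∀ f t S {xs} → xs ∈ branch prev f t S → key xs ≡ S
    key-branch f t S xs∈ with fits S t | xs∈
    ... | true | xs∈′ with ∈-map⁻ (extend S) xs∈′
    ...   | ys , _ , refl = key-extend S ys

    key-branches : ∀ f t Ss {xs} → xs ∈ branches prev f t Ss → key xs ∈ Ss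
    key-branches f t (S ∷ Ss) xs∈ with ∈-++⁻ (branch prev f t S) xs∈
    ... | inj₁ xs∈S = here (key-branch f t S xs∈S)
    ... | inj₂ xs∈Ss = there (key-branches f t Ss xs∈Ss)

    mutual
      level-unique : ∀ f t → Unique (level prev f t)
      level-unique f zero = []
      level-unique f (suc t) = branches-unique f (suc t) sub124s sub124s-unique

      branches-unique : ∀ f t Ss → Unique Ss → Unique (branches prev f t Ss)
      branches-unique f t [] _ = []
      branches-unique f t (S ∷ Ss) (S∉Ss ∷ Ss-unique) =
        ++⁺ (branch-unique f t S) (branches-unique f t Ss Ss-unique) disjoint
        where
        disjoint : ∀ {xs} → ¬ (xs ∈ branch prev f t S × xs ∈ branches prev f t Ss)
        disjoint (xs∈S , xs∈Ss) with key-branch f t S xs∈S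
        ... | refl = All¬⇒¬Any S∉Ss (key-branches f t Ss xs∈Ss)

      branch-unique : ∀ f t S → Unique (branch prev f t S)
      branch-unique f t S with fits S t
      ... | true = map⁺ (extend-injective S) (rest-unique f (size S) _)
      ... | false = []

      rest-unique : ∀ f p t → Unique (rest prev f p t)
      rest-unique f (suc p) t = prev-unique p t
      rest-unique zero zero t = []
      rest-unique (suc f) zero t = level-unique f t

  sets∸-unique : ∀ n p t → Unique (sets∸ n p t)
  sets∸-unique zero zero zero = All.[] ∷ []
  sets∸-unique zero zero (suc t) = []
  sets∸-unique zero (suc p) t = []
  sets∸-unique (suc n) zero t = level-unique (sets∸-unique n) 2 t
  sets∸-unique (suc n) (suc p) t = sets∸-unique n p t

module Counting where

  open import Defs
  open import Data.Nat using (ℕ; zero; suc; _+_; _*_; _≤_; s≤s)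
  open import Data.Nat.Properties using (+-cancelʳ-≡; +-identityʳ; *-distribˡ-+)
  open import Data.Nat.Tactic.RingSolver using (solve-∀)
  open import Data.Product using (_×_; _,_; proj₁)
  open import Relation.Binary.PropositionalEquality using (_≡_; refl; sym; cong; cong₂; module ≡-Reasoning)
  open Solution using (solution; triSum; astSum; tpSum)
  open Enumeration using (count)

  open ≡-Reasoning

  Recurrence : (ℕ → ℕ) → Set
  Recurrence x = ∀ k → x (4 + k) + x k ≡ x (3 + k) + 2 * x (2 + k)

  recurrence-agree : ∀ {x y} → Recurrence x → Recurrence y →
    x 0 ≡ y 0 → x 1 ≡ y 1 → x 2 ≡ y 2 → x 3 ≡ y 3 → ∀ k → x k ≡ y k
  recurrence-agree {x} {y} x-rec y-rec e₀ e₁ e₂ e₃ k = proj₁ (window k)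
    where
    window : ∀ k → (x k ≡ y k) × (x (1 + k) ≡ y (1 + k)) × (x (2 + k) ≡ y (2 + k)) × (x (3 + k) ≡ y (3 + k))
    window zero = e₀ , e₁ , e₂ , e₃
    window (suc k) with window k
    ... | a₀ , a₁ , a₂ , a₃ = a₁ , a₂ , a₃ , +-cancelʳ-≡ (x k) _ _ (begin
      x (4 + k) + x k               ≡⟨ x-rec k ⟩
      x (3 + k) + 2 * x (2 + k)     ≡⟨ cong₂ (λ u v → u + 2 * v) a₃ a₂ ⟩
      y (3 + k) + 2 * y (2 + k)     ≡⟨ y-rec k ⟨
      y (4 + k) + y k               ≡⟨ cong (y (4 + k) +_) a₀ ⟨
      y (4 + k) + x k               ∎)

  Recurrence-scale : ∀ c {x} → Recurrence x → Recurrence (λ k → c * x k)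
  Recurrence-scale c {x} x-rec k = begin
    c * x (4 + k) + c * x k         ≡⟨ *-distribˡ-+ c (x (4 + k)) (x k) ⟨
    c * (x (4 + k) + x k)           ≡⟨ cong (c *_) (x-rec k) ⟩
    c * (x (3 + k) + 2 * x (2 + k)) ≡⟨ distrib c (x (3 + k)) (x (2 + k)) ⟩
    c * x (3 + k) + 2 * (c * x (2 + k)) ∎
    where
    distrib : ∀ c a b → c * (a + 2 * b) ≡ c * a + 2 * (c * b)
    distrib = solve-∀

  Recurrence-cong : ∀ {x y} → (∀ k → x k ≡ y k) → Recurrence x → Recurrence y
  Recurrence-cong {x} {y} x≡y x-rec k = begin
    y (4 + k) + y k             ≡⟨ cong₂ _+_ (x≡y (4 + k)) (x≡y k) ⟨
    x (4 + k) + x k             ≡⟨ x-rec k ⟩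
    x (3 + k) + 2 * x (2 + k)   ≡⟨ cong₂ (λ u v → u + 2 * v) (x≡y (3 + k)) (x≡y (2 + k)) ⟩
    y (3 + k) + 2 * y (2 + k)   ∎

  -- With the shift E, the hypotheses read E(E − 1) s = (E² − E + 1) t and (E − 1)(E + 1)²(E² − E + 1) t = E⁴ s,
  -- so E³ s = (E² − 1)² s.  The proof adds the common term X to both sides to stay in ℕ.
  coupled⇒Recurrence : ∀ {s t : ℕ → ℕ} →
    (∀ k → s (2 + k) + t (1 + k) ≡ t (2 + k) + s (1 + k) + t k) →
    (∀ k → t (5 + k) + t (2 + k) ≡ s (4 + k) + t (3 + k) + t k) →
    Recurrence (λ k → s (1 + k))
  coupled⇒Recurrence {s} {t} s-step t-step k = +-cancelʳ-≡ X _ _ (begin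
    s (5 + k) + s (1 + k) + X
      ≡⟨ regroup (s (5 + k)) (s (4 + k)) (s (3 + k)) (s (2 + k)) (s (1 + k))
                 (t (5 + k)) (t (4 + k)) (t (3 + k)) (t (2 + k)) (t (1 + k)) (t k) ⟩
    s (4 + k) + 2 * s (3 + k) +
      (s (5 + k) + t (4 + k) + (s (4 + k) + t (3 + k)) + (t (3 + k) + s (2 + k) + t (1 + k)) +
       (t (2 + k) + s (1 + k) + t k) + (t (5 + k) + t (2 + k)))
      ≡⟨ cong (s (4 + k) + 2 * s (3 + k) +_)
           (cong₂ _+_ (cong₂ _+_ (cong₂ _+_ (cong₂ _+_ (s-step (3 + k)) (s-step (2 + k))) (sym (s-step (1 + k))))
                       (sym (s-step k)))
                  (t-step k)) ⟩
    s (4 + k) + 2 * s (3 + k) + X ∎)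
    where
    X = t (5 + k) + s (4 + k) + t (3 + k) + (t (4 + k) + s (3 + k) + t (2 + k)) + (s (3 + k) + t (2 + k)) +
        (s (2 + k) + t (1 + k)) + (s (4 + k) + t (3 + k) + t k)
    regroup : ∀ s₀ s₁ s₂ s₃ s₄ t₀ t₁ t₂ t₃ t₄ t₅ →
      s₀ + s₄ + (t₀ + s₁ + t₂ + (t₁ + s₂ + t₃) + (s₂ + t₃) + (s₃ + t₄) + (s₁ + t₂ + t₅)) ≡
      s₁ + 2 * s₂ + (s₀ + t₁ + (s₁ + t₂) + (t₂ + s₃ + t₄) + (t₃ + s₄ + t₅) + (t₀ + t₃))
    regroup = solve-∀

  module _ where
    private
      flatten₂ : ∀ a b → a + (b + 0) ≡ a + b
      flatten₂ = solve-∀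
      flatten₃ : ∀ a b c → a + (b + (c + 0)) ≡ a + b + c
      flatten₃ = solve-∀
      flatten₄ : ∀ a b c d → a + (b + (c + (d + 0))) ≡ a + b + c + d
      flatten₄ = solve-∀

    -- The S that fit a target, e.g. {2, 4}, {1}, {1, 4}, {1, 2} for 6 quarters, leaving 9, 6, 3, 0 quarters
    -- to Y; the equations hold by evaluation.
    count-3-step : ∀ n → count (2 + n) 3 ≡ count (2 + n) 9 + count (1 + n) 6 + count (1 + n) 3 + count n 0
    count-3-step n = flatten₄ (count (2 + n) 9) (count (1 + n) 6) (count (1 + n) 3) (count n 0)

    count-4-step : ∀ n → count (2 + n) 4 ≡ count (1 + n) 9 + count (1 + n) 6 + count n 3
    count-4-step n = flatten₃ (count (1 + n) 9) (count (1 + n) 6) (count n 3)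

    count-6-step : ∀ n → count (2 + n) 6 ≡ count n 9 + count (1 + n) 6 + count n 3 + count n 0
    count-6-step n = flatten₄ (count n 9) (count (1 + n) 6) (count n 3) (count n 0)

    count-9-step : ∀ n → count (3 + n) 9 ≡ count (1 + n) 9 + count n 6
    count-9-step n = flatten₂ (count (1 + n) 9) (count n 6)

  count-3≡6+6 : ∀ m → count (1 + m) 3 ≡ count (1 + m) 6 + count m 6
  count-3≡6+6 m = proj₁ (pair m)
    where
    rearrange : ∀ a b c d → a + b + c + (c + d) + 0 ≡ a + c + (d + b) + 0 + c
    rearrange = solve-∀
    pair : ∀ m → (count (1 + m) 3 ≡ count (1 + m) 6 + count m 6) ×
                 (count (2 + m) 3 ≡ count (2 + m) 6 + count (1 + m) 6)
    pair zero = refl , refl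
    pair (suc m) with pair m
    ... | ih₁ , ih₂ = ih₂ , (begin
      count (3 + m) 3
        ≡⟨ count-3-step (1 + m) ⟩
      count (3 + m) 9 + count (2 + m) 6 + count (2 + m) 3 + 0
        ≡⟨ cong₂ (λ u v → u + count (2 + m) 6 + v + 0) (count-9-step m) ih₂ ⟩
      count (1 + m) 9 + count m 6 + count (2 + m) 6 + (count (2 + m) 6 + count (1 + m) 6) + 0
        ≡⟨ rearrange (count (1 + m) 9) (count m 6) (count (2 + m) 6) (count (1 + m) 6) ⟩
      count (1 + m) 9 + count (2 + m) 6 + (count (1 + m) 6 + count m 6) + 0 + count (2 + m) 6
        ≡⟨ cong (λ u → count (1 + m) 9 + count (2 + m) 6 + u + 0 + count (2 + m) 6) ih₁ ⟨
      count (1 + m) 9 + count (2 + m) 6 + count (1 + m) 3 + 0 + count (2 + m) 6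
        ≡⟨ cong (_+ count (2 + m) 6) (count-6-step (1 + m)) ⟨
      count (3 + m) 6 + count (2 + m) 6 ∎)

  count-4≡2*6 : ∀ j → count (4 + j) 4 ≡ 2 * count (3 + j) 6
  count-4≡2*6 j = begin
    count (4 + j) 4
      ≡⟨ count-4-step (2 + j) ⟩
    count (3 + j) 9 + count (3 + j) 6 + count (2 + j) 3
      ≡⟨ cong₂ (λ u v → u + count (3 + j) 6 + v) (count-9-step j) (count-3≡6+6 (1 + j)) ⟩
    count (1 + j) 9 + count j 6 + count (3 + j) 6 + (count (2 + j) 6 + count (1 + j) 6)
      ≡⟨ rearrange (count (1 + j) 9) (count j 6) (count (3 + j) 6) (count (2 + j) 6) (count (1 + j) 6) ⟩
    count (3 + j) 6 + (count (1 + j) 9 + count (2 + j) 6 + (count (1 + j) 6 + count j 6) + 0)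
      ≡⟨ cong (λ u → count (3 + j) 6 + (count (1 + j) 9 + count (2 + j) 6 + u + 0)) (count-3≡6+6 j) ⟨
    count (3 + j) 6 + (count (1 + j) 9 + count (2 + j) 6 + count (1 + j) 3 + 0)
      ≡⟨ cong (count (3 + j) 6 +_) (count-6-step (1 + j)) ⟨
    count (3 + j) 6 + count (3 + j) 6
      ≡⟨ cong (count (3 + j) 6 +_) (+-identityʳ (count (3 + j) 6)) ⟨
    2 * count (3 + j) 6 ∎
    where
    rearrange : ∀ a b c d e → a + b + c + (d + e) ≡ c + (a + d + (e + b) + 0)
    rearrange = solve-∀

  count-6-recurrence : Recurrence (λ k → count (1 + k) 6)
  count-6-recurrence j = begin
    count (5 + j) 6 + count (1 + j) 6
      ≡⟨ cong (_+ count (1 + j) 6) (count-6-step (3 + j)) ⟩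
    count (3 + j) 9 + count (4 + j) 6 + count (3 + j) 3 + 0 + count (1 + j) 6
      ≡⟨ cong₂ (λ u v → u + count (4 + j) 6 + v + 0 + count (1 + j) 6) (count-9-step j) (count-3≡6+6 (2 + j)) ⟩
    count (1 + j) 9 + count j 6 + count (4 + j) 6 + (count (3 + j) 6 + count (2 + j) 6) + 0 + count (1 + j) 6
      ≡⟨ rearrange (count (1 + j) 9) (count j 6) (count (4 + j) 6) (count (3 + j) 6) (count (2 + j) 6)
                   (count (1 + j) 6) ⟩
    count (4 + j) 6 + count (3 + j) 6 + (count (1 + j) 9 + count (2 + j) 6 + (count (1 + j) 6 + count j 6) + 0)
      ≡⟨ cong (λ u → count (4 + j) 6 + count (3 + j) 6 + (count (1 + j) 9 + count (2 + j) 6 + u + 0)) (count-3≡6+6 j) ⟨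
    count (4 + j) 6 + count (3 + j) 6 + (count (1 + j) 9 + count (2 + j) 6 + count (1 + j) 3 + 0)
      ≡⟨ cong (count (4 + j) 6 + count (3 + j) 6 +_) (count-6-step (1 + j)) ⟨
    count (4 + j) 6 + count (3 + j) 6 + count (3 + j) 6
      ≡⟨ twice (count (4 + j) 6) (count (3 + j) 6) ⟩
    count (4 + j) 6 + 2 * count (3 + j) 6 ∎
    where
    rearrange : ∀ a b h₄ h₃ h₂ h₁ → a + b + h₄ + (h₃ + h₂) + 0 + h₁ ≡ h₄ + h₃ + (a + h₂ + (h₁ + b) + 0)
    rearrange = solve-∀
    twice : ∀ a b → a + b + b ≡ a + 2 * b
    twice = solve-∀

  count-4-recurrence : Recurrence (λ k → count (4 + k) 4)
  count-4-recurrence =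
    Recurrence-cong {λ k → 2 * count (3 + k) 6} (λ k → sym (count-4≡2*6 k))
      (Recurrence-scale 2 {λ k → count (3 + k) 6} (λ k → count-6-recurrence (2 + k)))

  module _ where
    private
      S T A U : ℕ → ℕ
      S = total solution
      T = triSum solution
      A = astSum solution
      U = tpSum solution

    total-split : ∀ n → S n ≡ T n + A n
    total-split n = regroup (tri solution n) (sq solution n) (ast solution n) (dia solution n)
                            (St1 solution n) (St2 solution n) (St solution n)
      where
      regroup : ∀ a b c d e f g → a + b + c + d + e + f + g ≡ (a + b + e + f + g) + (c + d)
      regroup = solve-∀

    -- From these indices on the δ terms of the system evaluate to 0, but only as a summand + 0.
    astSum-step : ∀ k → A (5 + k) ≡ A (4 + k) + T (3 + k)
    astSum-step k = cong (_+ T (3 + k)) (+-identityʳ (A (4 + k)))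

    tpSum-step : ∀ k → U (6 + k) ≡ A (6 + k) + U (4 + k) + T (4 + k)
    tpSum-step k = cong (λ u → A (6 + k) + u + T (4 + k)) (+-identityʳ (U (4 + k)))

    triSum-step : ∀ k → T (9 + k) ≡ T (8 + k) + A (8 + k) + A (6 + k) + U (4 + k) + T (4 + k)
    triSum-step k =
      cong₂ (λ a u → T (8 + k) + A (8 + k) + a + u + T (4 + k)) (+-identityʳ (A (6 + k))) (+-identityʳ (U (4 + k)))

    total-step : ∀ k → S (5 + k) + T (4 + k) ≡ T (5 + k) + S (4 + k) + T (3 + k)
    total-step k = begin
      S (5 + k) + T (4 + k)                      ≡⟨ cong (_+ T (4 + k)) (total-split (5 + k)) ⟩
      T (5 + k) + A (5 + k) + T (4 + k)          ≡⟨ cong (λ a → T (5 + k) + a + T (4 + k)) (astSum-step k) ⟩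
      T (5 + k) + (A (4 + k) + T (3 + k)) + T (4 + k)
        ≡⟨ regroup (T (5 + k)) (A (4 + k)) (T (3 + k)) (T (4 + k)) ⟩
      T (5 + k) + (T (4 + k) + A (4 + k)) + T (3 + k) ≡⟨ cong (λ s → T (5 + k) + s + T (3 + k)) (total-split (4 + k)) ⟨
      T (5 + k) + S (4 + k) + T (3 + k)          ∎
      where
      regroup : ∀ t₅ a₄ t₃ t₄ → t₅ + (a₄ + t₃) + t₄ ≡ t₅ + (t₄ + a₄) + t₃
      regroup = solve-∀

    triSum-total-step : ∀ k → T (11 + k) + T (8 + k) ≡ S (10 + k) + T (9 + k) + T (6 + k)
    triSum-total-step k = begin
      T (11 + k) + T (8 + k)
        ≡⟨ cong (_+ T (8 + k)) (triSum-step (2 + k)) ⟩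
      T (10 + k) + A (10 + k) + A (8 + k) + U (6 + k) + T (6 + k) + T (8 + k)
        ≡⟨ cong (λ u → T (10 + k) + A (10 + k) + A (8 + k) + u + T (6 + k) + T (8 + k)) (tpSum-step k) ⟩
      T (10 + k) + A (10 + k) + A (8 + k) + (A (6 + k) + U (4 + k) + T (4 + k)) + T (6 + k) + T (8 + k)
        ≡⟨ regroup (T (10 + k)) (A (10 + k)) (A (8 + k)) (A (6 + k)) (U (4 + k)) (T (4 + k)) (T (6 + k)) (T (8 + k)) ⟩
      T (10 + k) + A (10 + k) + (T (8 + k) + A (8 + k) + A (6 + k) + U (4 + k) + T (4 + k)) + T (6 + k)
        ≡⟨ cong₂ (λ s t → s + t + T (6 + k)) (total-split (10 + k)) (triSum-step k) ⟨
      S (10 + k) + T (9 + k) + T (6 + k) ∎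
      where
      regroup : ∀ t₁₀ a₁₀ a₈ a₆ u₄ t₄ t₆ t₈ →
        t₁₀ + a₁₀ + a₈ + (a₆ + u₄ + t₄) + t₆ + t₈ ≡ t₁₀ + a₁₀ + (t₈ + a₈ + a₆ + u₄ + t₄) + t₆
      regroup = solve-∀

    total-recurrence : Recurrence (λ k → S (7 + k))
    total-recurrence = coupled⇒Recurrence {λ j → S (6 + j)} {λ j → T (6 + j)}
      (λ k → total-step (3 + k)) triSum-total-step

  total≡count : ∀ n → 3 ≤ n → total solution n ≡ count n 4
  total≡count 3 _ = refl
  total≡count 4 _ = refl
  total≡count 5 _ = refl
  total≡count 6 _ = refl
  total≡count (suc (suc (suc (suc (suc (suc (suc k))))))) _ =
    recurrence-agree {λ k → total solution (7 + k)} {λ k → count (7 + k) 4}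
      total-recurrence (λ k → count-4-recurrence (3 + k)) refl refl refl refl k
  total≡count 1 (s≤s ())
  total≡count 2 (s≤s (s≤s ()))

module Quarters where

  open import Defs using (recip; sumRecip)
  open import Data.Integer as ℤ using (ℤ; +_)
  import Data.Integer.Properties as ℤ
  open import Data.Integer.Tactic.RingSolver using (solve-∀)
  open import Data.List using ([]; _∷_)
  open import Data.Nat as ℕ using (ℕ; zero; suc; _∸_)
  import Data.Nat.Properties as ℕ
  open import Data.Rational using (ℚ; 0ℚ; _+_; _*_; _-_; _≤_; _<_; fromℚᵘ)
  open import Data.Rational.Properties
  open import Data.Rational.Solver using (module +-*-Solver)
  open import Data.Rational.Unnormalised as ℚᵘ using (ℚᵘ; mkℚᵘ; *≡*; *≤*)
  import Data.Rational.Unnormalised.Properties as ℚᵘ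
  open import Relation.Binary.PropositionalEquality using (_≡_; refl; sym; trans; cong; subst₂; module ≡-Reasoning)
  open +-*-Solver using (solve; _:=_; _:+_; _:*_; _:-_; con)

  fromℚᵘ-+ : ∀ p q → fromℚᵘ (p ℚᵘ.+ q) ≡ fromℚᵘ p + fromℚᵘ q
  fromℚᵘ-+ p q = toℚᵘ-injective (ℚᵘ.≃-trans (toℚᵘ-fromℚᵘ (p ℚᵘ.+ q))
    (ℚᵘ.≃-sym (ℚᵘ.≃-trans (toℚᵘ-homo-+ (fromℚᵘ p) (fromℚᵘ q)) (ℚᵘ.+-cong (toℚᵘ-fromℚᵘ p) (toℚᵘ-fromℚᵘ q)))))

  fromℚᵘ-* : ∀ p q → fromℚᵘ (p ℚᵘ.* q) ≡ fromℚᵘ p * fromℚᵘ q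
  fromℚᵘ-* p q = toℚᵘ-injective (ℚᵘ.≃-trans (toℚᵘ-fromℚᵘ (p ℚᵘ.* q))
    (ℚᵘ.≃-sym (ℚᵘ.≃-trans (toℚᵘ-homo-* (fromℚᵘ p) (fromℚᵘ q)) (ℚᵘ.*-cong (toℚᵘ-fromℚᵘ p) (toℚᵘ-fromℚᵘ q)))))

  -- mkℚᵘ n d denotes n / (d + 1).
  quarter : ℕ → ℚ
  quarter t = fromℚᵘ (mkℚᵘ (+ t) 3)

  ⅓ 3ℚ : ℚ
  ⅓ = fromℚᵘ (mkℚᵘ (+ 1) 2)
  3ℚ = fromℚᵘ (mkℚᵘ (+ 3) 0)

  quarter-+ : ∀ a b → quarter (a ℕ.+ b) ≡ quarter a + quarter b
  quarter-+ a b = trans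
    (fromℚᵘ-cong {mkℚᵘ (+ (a ℕ.+ b)) 3} {mkℚᵘ (+ a) 3 ℚᵘ.+ mkℚᵘ (+ b) 3}
      (*≡* (trans (cong (ℤ._* + 16) (ℤ.pos-+ a b)) (cross-multiply (+ a) (+ b)))))
    (fromℚᵘ-+ (mkℚᵘ (+ a) 3) (mkℚᵘ (+ b) 3))
    where
    cross-multiply : ∀ x y → (x ℤ.+ y) ℤ.* + 16 ≡ (x ℤ.* + 4 ℤ.+ y ℤ.* + 4) ℤ.* + 4
    cross-multiply = solve-∀

  quarter-3*-⅓ : ∀ d → quarter (3 ℕ.* d) * ⅓ ≡ quarter d
  quarter-3*-⅓ d = trans
    (sym (fromℚᵘ-* (mkℚᵘ (+ (3 ℕ.* d)) 3) (mkℚᵘ (+ 1) 2)))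
    (fromℚᵘ-cong {mkℚᵘ (+ (3 ℕ.* d)) 3 ℚᵘ.* mkℚᵘ (+ 1) 2} {mkℚᵘ (+ d) 3}
      (*≡* (trans (cong (λ z → (z ℤ.* + 1) ℤ.* + 4) (ℤ.pos-* 3 d)) (cross-multiply (+ d)))))
    where
    cross-multiply : ∀ x → (+ 3 ℤ.* x ℤ.* + 1) ℤ.* + 4 ≡ x ℤ.* + 12
    cross-multiply = solve-∀

  recip-3* : ∀ y → recip (3 ℕ.* y) ≡ recip y * ⅓
  recip-3* zero = refl
  recip-3* (suc k) = trans
    (fromℚᵘ-cong {mkℚᵘ (+ 1) (ℕ.pred (3 ℕ.* suc k))} {mkℚᵘ (+ 1) k ℚᵘ.* mkℚᵘ (+ 1) 2}
      (*≡* (trans (ℤ.*-identityˡ _) (trans (cong +_ (ℕ.*-comm (suc k) 3)) (sym (ℤ.*-identityˡ _))))))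
    (fromℚᵘ-* (mkℚᵘ (+ 1) k) (mkℚᵘ (+ 1) 2))

  quarter-cancel-≤ : ∀ {a b} → quarter a ≤ quarter b → a ℕ.≤ b
  quarter-cancel-≤ {a} {b} qa≤qb
    with ℚᵘ.≤-respʳ-≃ (toℚᵘ-fromℚᵘ (mkℚᵘ (+ b) 3)) (ℚᵘ.≤-respˡ-≃ (toℚᵘ-fromℚᵘ (mkℚᵘ (+ a) 3)) (toℚᵘ-mono-≤ qa≤qb))
  ... | *≤* 4a≤4b = ℕ.*-cancelʳ-≤ a b 4 (ℤ.drop‿+≤+ (subst₂ ℤ._≤_ (sym (ℤ.pos-* a 4)) (sym (ℤ.pos-* b 4)) 4a≤4b))

  quarter-mono-≤ : ∀ {a b} → a ℕ.≤ b → quarter a ≤ quarter b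
  quarter-mono-≤ {a} {b} a≤b = toℚᵘ-cancel-≤ (ℚᵘ.≤-respʳ-≃ (ℚᵘ.≃-sym (toℚᵘ-fromℚᵘ (mkℚᵘ (+ b) 3)))
    (ℚᵘ.≤-respˡ-≃ (ℚᵘ.≃-sym (toℚᵘ-fromℚᵘ (mkℚᵘ (+ a) 3)))
      (*≤* (subst₂ ℤ._≤_ (ℤ.pos-* a 4) (ℤ.pos-* b 4) (ℤ.+≤+ (ℕ.*-monoˡ-≤ 4 a≤b))))))

  recip-pos : ∀ k → 0ℚ < recip (suc k)
  recip-pos k = positive⁻¹ (recip (suc k)) {{normalize-pos 1 (suc k)}}

  recip-nonNeg : ∀ x → 0ℚ ≤ recip x
  recip-nonNeg zero = ≤-refl
  recip-nonNeg (suc k) = <⇒≤ (recip-pos k)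

  sumRecip-nonNeg : ∀ xs → 0ℚ ≤ sumRecip xs
  sumRecip-nonNeg [] = ≤-refl
  sumRecip-nonNeg (x ∷ xs) = +-mono-≤ (recip-nonNeg x) (sumRecip-nonNeg xs)

  sumRecip-pos : ∀ k xs → 0ℚ < sumRecip (suc k ∷ xs)
  sumRecip-pos k xs = +-mono-<-≤ (recip-pos k) (sumRecip-nonNeg xs)

  quarter-+-⅓ : ∀ w d → quarter w + quarter (3 ℕ.* d) * ⅓ ≡ quarter (w ℕ.+ d)
  quarter-+-⅓ w d = trans (cong (λ r → quarter w + r) (quarter-3*-⅓ d)) (sym (quarter-+ w d))

  quarter-+-⅓⇒≤ : ∀ {q w t} → 0ℚ ≤ q → quarter w + q * ⅓ ≡ quarter t → w ℕ.≤ t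
  quarter-+-⅓⇒≤ {q} {w} q≥0 eq = quarter-cancel-≤ (subst₂ _≤_ (+-identityʳ (quarter w)) eq
    (+-monoʳ-≤ (quarter w) (*-monoʳ-≤-nonNeg ⅓ q≥0)))

  quarter-+-⅓⇒≡ : ∀ {q w t} → w ℕ.≤ t → quarter w + q * ⅓ ≡ quarter t → q ≡ quarter (3 ℕ.* (t ∸ w))
  quarter-+-⅓⇒≡ {q} {w} {t} w≤t eq = begin
    q                                       ≡⟨ isolate q (quarter w) ⟩
    (quarter w + q * ⅓ - quarter w) * 3ℚ    ≡⟨ cong (λ r → (r - quarter w) * 3ℚ) eq ⟩
    (quarter t - quarter w) * 3ℚ            ≡⟨ cong (λ r → (quarter r - quarter w) * 3ℚ) (ℕ.m+[n∸m]≡n w≤t) ⟨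
    (quarter (w ℕ.+ d) - quarter w) * 3ℚ    ≡⟨ cong (λ r → (r - quarter w) * 3ℚ) (quarter-+-⅓ w d) ⟨
    (quarter w + quarter (3 ℕ.* d) * ⅓ - quarter w) * 3ℚ ≡⟨ isolate (quarter (3 ℕ.* d)) (quarter w) ⟨
    quarter (3 ℕ.* d)                       ∎
    where
    open ≡-Reasoning
    d = t ∸ w
    isolate : ∀ q a → q ≡ (a + q * ⅓ - a) * 3ℚ
    isolate = solve 2 (λ q a → q := (a :+ q :* con ⅓ :- a) :* con 3ℚ) refl

module Extension where

  open import Defs using (Form23; recip; sumRecip)
  open import Data.Bool using (Bool; true; false)
  open import Data.List using (List; []; _∷_; map; length)
  open import Data.List.Properties using (length-map)
  open import Data.List.Relation.Unary.All as All using (All; []; _∷_)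
  import Data.List.Relation.Unary.All.Properties as All
  open import Data.List.Relation.Unary.AllPairs using (_∷_)
  open import Data.List.Relation.Unary.Linked as Linked using (Linked; []; [-]; _∷_)
  open import Data.List.Relation.Unary.Linked.Properties using (Linked⇒AllPairs; map⁺)
  open import Data.Nat as ℕ using (ℕ; suc; _+_; _*_; _^_; _≤_; _<_; z≤n; s≤s)
  open import Data.Nat.Properties as ℕ using (<-trans; <-≤-trans; ≤-trans; *-monoʳ-<; *-monoʳ-≤)
  open import Data.Nat.Tactic.RingSolver using (solve-∀)
  open import Data.Product using (_×_; _,_)
  open import Data.Rational as ℚ using (ℚ; 0ℚ)
  import Data.Rational.Properties as ℚ
  open import Data.Rational.Solver using (module +-*-Solver)
  open import Relation.Binary.PropositionalEquality using (_≡_; refl; sym; trans; cong; cong₂; module ≡-Reasoning)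
  open Enumeration using (weight; size; count𝔹; triple; consIf; with4; extend)
  open Quarters using (quarter; ⅓; recip-3*)
  open +-*-Solver using (solve; _:=_; _:+_; _:*_; con)

  Sorted23 : List ℕ → Set
  Sorted23 xs = Linked _<_ xs × All Form23 xs

  form23-pos : ∀ {x} → Form23 x → 0 < x
  form23-pos (a , b , _ , refl) = ℕ.*-mono-≤ (ℕ.m^n>0 2 a) (ℕ.m^n>0 3 b)

  form23-1 : Form23 1
  form23-1 = 0 , 0 , z≤n , refl

  form23-2 : Form23 2
  form23-2 = 1 , 0 , s≤s z≤n , refl

  form23-3 : Form23 3
  form23-3 = 0 , 1 , z≤n , refl

  form23-4 : Form23 4
  form23-4 = 2 , 0 , s≤s (s≤s z≤n) , refl

  form23-3* : ∀ {y} → Form23 y → Form23 (3 * y)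
  form23-3* (a , b , a≤2 , refl) = a , suc b , a≤2 , swap (2 ^ a) (3 ^ b)
    where
    swap : ∀ p q → 3 * (p * q) ≡ p * (3 * q)
    swap = solve-∀

  linked-head : ∀ {x xs} → Linked _<_ (x ∷ xs) → All (x <_) xs
  linked-head l with Linked⇒AllPairs <-trans l
  ... | x<xs ∷ _ = x<xs

  linked-cons : ∀ {x zs} → All (x <_) zs → Linked _<_ zs → Linked _<_ (x ∷ zs)
  linked-cons [] _ = [-]
  linked-cons (x<z ∷ _) l = x<z ∷ l

  triple-linked : ∀ {ys} → Linked _<_ ys → Linked _<_ (triple ys)
  triple-linked l = map⁺ (Linked.map (*-monoʳ-< 3) l)

  triple-above : ∀ {k m ys} → k < 3 * m → All (m ≤_) ys → All (k <_) (triple ys)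
  triple-above k<3m [] = []
  triple-above k<3m (m≤y ∷ m≤ys) = <-≤-trans k<3m (*-monoʳ-≤ 3 m≤y) ∷ triple-above k<3m m≤ys

  linked-≥ : ∀ {m x xs} → m ≤ x → Linked _<_ (x ∷ xs) → All (m ≤_) (x ∷ xs)
  linked-≥ m≤x l = m≤x ∷ All.map (λ x<z → ≤-trans m≤x (ℕ.<⇒≤ x<z)) (linked-head l)

  2<4 : 2 < 4
  2<4 = s≤s (s≤s (s≤s z≤n))

  4<3*2 : 4 < 3 * 2
  4<3*2 = s≤s (s≤s (s≤s (s≤s (s≤s z≤n))))

  with4-linked : ∀ b {ys} → All (0 <_) ys → Linked _<_ ys → Linked _<_ (with4 b ys)
  with4-linked false _ l = triple-linked l
  with4-linked true {[]} _ _ = [-]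
  with4-linked true {0 ∷ ys} (() ∷ _) _
  with4-linked true {1 ∷ ys} _ l =
    ℕ.≤-refl ∷ linked-cons (triple-above 4<3*2 (linked-head l)) (triple-linked (Linked.tail l))
  with4-linked true {suc (suc y) ∷ ys} _ l =
    linked-cons (triple-above 4<3*2 (linked-≥ (s≤s (s≤s z≤n)) l)) (triple-linked l)

  with4-above : ∀ b {ys} → All (0 <_) ys → All (2 <_) (with4 b ys)
  with4-above false ys>0 = triple-above ℕ.≤-refl ys>0
  with4-above true {[]} _ = 2<4 ∷ []
  with4-above true {1 ∷ ys} (_ ∷ ys>0) = ℕ.≤-refl ∷ 2<4 ∷ triple-above ℕ.≤-refl ys>0
  with4-above true {suc (suc y) ∷ ys} ys>0 = 2<4 ∷ triple-above ℕ.≤-refl ys>0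
  with4-above true {0 ∷ ys} (() ∷ _)

  consIf-linked : ∀ b {x zs} → All (x <_) zs → Linked _<_ zs → Linked _<_ (consIf b x zs)
  consIf-linked true x<zs l = linked-cons x<zs l
  consIf-linked false _ l = l

  consIf-above : ∀ b {k x zs} → k < x → All (k <_) zs → All (k <_) (consIf b x zs)
  consIf-above true k<x k<zs = k<x ∷ k<zs
  consIf-above false _ k<zs = k<zs

  triple-form23 : ∀ {ys} → All Form23 ys → All Form23 (triple ys)
  triple-form23 f = All.map⁺ (All.map form23-3* f)

  with4-form23 : ∀ b {ys} → All Form23 ys → All Form23 (with4 b ys)
  with4-form23 false f = triple-form23 f
  with4-form23 true {[]} _ = form23-4 ∷ []
  with4-form23 true {0 ∷ ys} f = form23-4 ∷ triple-form23 f
  with4-form23 true {1 ∷ ys} (_ ∷ f) = form23-3 ∷ form23-4 ∷ triple-form23 f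
  with4-form23 true {suc (suc y) ∷ ys} f = form23-4 ∷ triple-form23 f

  consIf-form23 : ∀ b {x zs} → Form23 x → All Form23 zs → All Form23 (consIf b x zs)
  consIf-form23 true fx f = fx ∷ f
  consIf-form23 false _ f = f

  extend-sorted23 : ∀ S {ys} → Sorted23 ys → Sorted23 (extend S ys)
  extend-sorted23 (b₁ , b₂ , b₄) {ys} (l , f) =
    consIf-linked b₁ (consIf-above b₂ ℕ.≤-refl (All.map (<-trans ℕ.≤-refl) above2))
      (consIf-linked b₂ above2 (with4-linked b₄ pos l)) ,
    consIf-form23 b₁ form23-1 (consIf-form23 b₂ form23-2 (with4-form23 b₄ f))
    where
    pos = All.map form23-pos f
    above2 = with4-above b₄ pos

  length-with4 : ∀ b ys → length (with4 b ys) ≡ count𝔹 b + length ys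
  length-with4 false ys = length-map (3 *_) ys
  length-with4 true [] = refl
  length-with4 true (0 ∷ ys) = cong (2 +_) (length-map (3 *_) ys)
  length-with4 true (1 ∷ ys) = cong (2 +_) (length-map (3 *_) ys)
  length-with4 true (suc (suc y) ∷ ys) = cong (2 +_) (length-map (3 *_) ys)

  length-consIf : ∀ b x zs → length (consIf b x zs) ≡ count𝔹 b + length zs
  length-consIf true x zs = refl
  length-consIf false x zs = refl

  length-extend : ∀ S ys → length (extend S ys) ≡ size S + length ys
  length-extend (b₁ , b₂ , b₄) ys = begin
    length (consIf b₁ 1 (consIf b₂ 2 (with4 b₄ ys)))
      ≡⟨ length-consIf b₁ 1 _ ⟩
    count𝔹 b₁ + length (consIf b₂ 2 (with4 b₄ ys))
      ≡⟨ cong (count𝔹 b₁ +_) (trans (length-consIf b₂ 2 _) (cong (count𝔹 b₂ +_) (length-with4 b₄ ys))) ⟩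
    count𝔹 b₁ + (count𝔹 b₂ + (count𝔹 b₄ + length ys))
      ≡⟨ regroup (count𝔹 b₁) (count𝔹 b₂) (count𝔹 b₄) (length ys) ⟩
    count𝔹 b₁ + count𝔹 b₂ + count𝔹 b₄ + length ys ∎
    where
    open ≡-Reasoning
    regroup : ∀ a b c d → a + (b + (c + d)) ≡ a + b + c + d
    regroup = solve-∀

  triple-sumRecip : ∀ ys → sumRecip (triple ys) ≡ sumRecip ys ℚ.* ⅓
  triple-sumRecip [] = refl
  triple-sumRecip (y ∷ ys) =
    trans (cong₂ ℚ._+_ (recip-3* y) (triple-sumRecip ys)) (sym (ℚ.*-distribʳ-+ ⅓ (recip y) (sumRecip ys)))

  ifℚ : Bool → ℚ → ℚ
  ifℚ true q = q
  ifℚ false q = 0ℚ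

  with4-sumRecip : ∀ b ys → sumRecip (with4 b ys) ≡ ifℚ b (recip 4) ℚ.+ sumRecip ys ℚ.* ⅓
  with4-sumRecip false ys = trans (triple-sumRecip ys) (sym (ℚ.+-identityˡ _))
  with4-sumRecip true [] = refl
  with4-sumRecip true (0 ∷ ys) = cong (recip 4 ℚ.+_) (triple-sumRecip (0 ∷ ys))
  with4-sumRecip true (1 ∷ ys) = trans (cong (λ r → recip 3 ℚ.+ (recip 4 ℚ.+ r)) (triple-sumRecip ys))
    (regroup (recip 4) (sumRecip ys))
    where
    regroup : ∀ a r → recip 3 ℚ.+ (a ℚ.+ r ℚ.* ⅓) ≡ a ℚ.+ (recip 1 ℚ.+ r) ℚ.* ⅓
    regroup = solve 2 (λ a r → con (recip 3) :+ (a :+ r :* con ⅓) := a :+ (con (recip 1) :+ r) :* con ⅓) refl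
  with4-sumRecip true (suc (suc y) ∷ ys) = cong (recip 4 ℚ.+_) (triple-sumRecip (suc (suc y) ∷ ys))

  consIf-sumRecip : ∀ b x zs → sumRecip (consIf b x zs) ≡ ifℚ b (recip x) ℚ.+ sumRecip zs
  consIf-sumRecip true x zs = refl
  consIf-sumRecip false x zs = sym (ℚ.+-identityˡ _)

  quarter-weight : ∀ b₁ b₂ b₄ →
    quarter (weight (b₁ , b₂ , b₄)) ≡ ifℚ b₁ (recip 1) ℚ.+ ifℚ b₂ (recip 2) ℚ.+ ifℚ b₄ (recip 4)
  quarter-weight true true true = refl
  quarter-weight true true false = refl
  quarter-weight true false true = refl
  quarter-weight true false false = refl
  quarter-weight false true true = refl
  quarter-weight false true false = refl
  quarter-weight false false true = refl
  quarter-weight false false false = refl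

  sumRecip-extend : ∀ S ys → sumRecip (extend S ys) ≡ quarter (weight S) ℚ.+ sumRecip ys ℚ.* ⅓
  sumRecip-extend (b₁ , b₂ , b₄) ys = begin
    sumRecip (consIf b₁ 1 (consIf b₂ 2 (with4 b₄ ys)))
      ≡⟨ consIf-sumRecip b₁ 1 (consIf b₂ 2 (with4 b₄ ys)) ⟩
    ifℚ b₁ (recip 1) ℚ.+ sumRecip (consIf b₂ 2 (with4 b₄ ys))
      ≡⟨ cong (ifℚ b₁ (recip 1) ℚ.+_)
           (trans (consIf-sumRecip b₂ 2 (with4 b₄ ys)) (cong (ifℚ b₂ (recip 2) ℚ.+_) (with4-sumRecip b₄ ys))) ⟩
    ifℚ b₁ (recip 1) ℚ.+ (ifℚ b₂ (recip 2) ℚ.+ (ifℚ b₄ (recip 4) ℚ.+ sumRecip ys ℚ.* ⅓))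
      ≡⟨ regroup (ifℚ b₁ (recip 1)) (ifℚ b₂ (recip 2)) (ifℚ b₄ (recip 4)) (sumRecip ys ℚ.* ⅓) ⟩
    ifℚ b₁ (recip 1) ℚ.+ ifℚ b₂ (recip 2) ℚ.+ ifℚ b₄ (recip 4) ℚ.+ sumRecip ys ℚ.* ⅓
      ≡⟨ cong (ℚ._+ sumRecip ys ℚ.* ⅓) (quarter-weight b₁ b₂ b₄) ⟨
    quarter (weight (b₁ , b₂ , b₄)) ℚ.+ sumRecip ys ℚ.* ⅓ ∎
    where
    open ≡-Reasoning
    regroup : ∀ a b c d → a ℚ.+ (b ℚ.+ (c ℚ.+ d)) ≡ a ℚ.+ b ℚ.+ c ℚ.+ d
    regroup = solve 4 (λ a b c d → a :+ (b :+ (c :+ d)) := a :+ b :+ c :+ d) refl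

module Soundness where

  open import Defs using (sumRecip)
  open import Data.Bool using (true)
  open import Data.Bool.Properties using (T-≡; T-∧)
  open import Data.List using (List; []; _∷_; length)
  open import Data.List.Membership.Propositional using (_∈_)
  open import Data.List.Membership.Propositional.Properties using (∈-map⁻; ∈-++⁻)
  open import Data.List.Relation.Unary.Any using (here)
  import Data.List.Relation.Unary.All as All
  import Data.List.Relation.Unary.Linked as Linked
  open import Data.Nat using (ℕ; zero; suc; _+_; _*_; _∸_; _≤_)
  open import Data.Nat.Properties using (≤ᵇ⇒≤; ≤⇒≤ᵇ; +-comm; +-identityʳ; +-suc; m+[n∸m]≡n)
  open import Data.Product using (_×_; _,_)
  import Data.Rational as ℚ
  open import Data.Sum using (inj₁; inj₂)
  open import Function.Bundles using (Equivalence)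
  open import Relation.Binary.PropositionalEquality using (_≡_; refl; trans; cong)
  open Enumeration
  open Quarters using (quarter; ⅓; quarter-+-⅓)
  open Extension using (Sorted23; extend-sorted23; length-extend; sumRecip-extend)

  open Equivalence using (to; from)

  fits⇒ : ∀ S t → fits S t ≡ true → weight S ≤ t × t ∸ weight S ≤ 3
  fits⇒ S t eq with to T-∧ (from T-≡ eq)
  ... | w≤t , d≤3 = ≤ᵇ⇒≤ _ _ w≤t , ≤ᵇ⇒≤ _ _ d≤3

  ⇒fits : ∀ S t → weight S ≤ t → t ∸ weight S ≤ 3 → fits S t ≡ true
  ⇒fits S t w≤t d≤3 = to T-≡ (from T-∧ (≤⇒≤ᵇ w≤t , ≤⇒≤ᵇ d≤3))

  Valid : ℕ → ℕ → ℕ → List ℕ → Set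
  Valid n p t xs = (length xs + p ≡ n) × Sorted23 xs × (sumRecip xs ≡ quarter t)

  module _ {N : ℕ} {prev : ℕ → ℕ → List (List ℕ)}
           (prev-sound : ∀ p t ys → ys ∈ prev p t → Valid N (suc p) t ys) where

    mutual
      level-sound : ∀ f t xs → xs ∈ level prev f t → Valid N 0 t xs
      level-sound f (suc t) xs xs∈ = branches-sound f (suc t) sub124s xs xs∈

      branches-sound : ∀ f t Ss xs → xs ∈ branches prev f t Ss → Valid N 0 t xs
      branches-sound f t (S ∷ Ss) xs xs∈ with ∈-++⁻ (branch prev f t S) xs∈
      ... | inj₁ xs∈S = branch-sound f t S xs xs∈S
      ... | inj₂ xs∈Ss = branches-sound f t Ss xs xs∈Ss

      branch-sound : ∀ f t S xs → xs ∈ branch prev f t S → Valid N 0 t xs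
      branch-sound f t S xs xs∈ with fits S t in fits-eq | xs∈
      ... | true | xs∈′ with ∈-map⁻ (extend S) xs∈′
      ...   | ys , ys∈ , refl with rest-sound f (size S) _ ys ys∈ | fits⇒ S t fits-eq
      ...     | length-ys , sorted-ys , sum-ys | w≤t , _ =
        trans (+-identityʳ _) (trans (length-extend S ys) (trans (+-comm (size S) (length ys)) length-ys)) ,
        extend-sorted23 S sorted-ys ,
        trans (sumRecip-extend S ys)
          (trans (cong (λ r → quarter (weight S) ℚ.+ r ℚ.* ⅓) sum-ys)
            (trans (quarter-+-⅓ (weight S) (t ∸ weight S)) (cong quarter (m+[n∸m]≡n w≤t))))

      rest-sound : ∀ f p t ys → ys ∈ rest prev f p t → Valid N p t ys
      rest-sound f (suc p) t ys ys∈ = prev-sound p t ys ys∈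
      rest-sound (suc f) zero t ys ys∈ = level-sound f t ys ys∈

  sets∸-sound : ∀ n p t xs → xs ∈ sets∸ n p t → Valid n p t xs
  sets∸-sound zero zero zero .[] (here refl) = refl , (Linked.[] , All.[]) , refl
  sets∸-sound (suc n) zero t xs xs∈ = level-sound prev-sound 2 t xs xs∈
    where
    prev-sound : ∀ p t ys → ys ∈ sets∸ n p t → Valid (suc n) (suc p) t ys
    prev-sound p t ys ys∈ with sets∸-sound n p t ys ys∈
    ... | length-ys , rest = trans (+-suc _ p) (cong suc length-ys) , rest
  sets∸-sound (suc n) (suc p) t xs xs∈ with sets∸-sound n p t xs xs∈
  ... | length-xs , rest = trans (+-suc _ p) (cong suc length-xs) , rest

module Decomposition where

  open import Defs using (Form23)
  open import Data.Bool using (Bool; true; false)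
  open import Data.Empty using (⊥-elim)
  open import Data.List using (List; []; _∷_)
  open import Data.List.Relation.Unary.All as All using (All; []; _∷_)
  open import Data.List.Relation.Unary.Linked as Linked using (Linked)
  open import Data.List.Relation.Unary.Linked.Properties using (map⁻)
  open import Data.Nat using (ℕ; suc; _*_; _^_; _≤_; _<_; z≤n; s≤s; _≟_)
  open import Data.Nat.Properties using (<-trans; <-irrefl; ≤-antisym; ≤-pred; ≤∧≢⇒<; *-cancelˡ-<; ≤-<-trans)
  open import Data.Nat.Tactic.RingSolver using (solve-∀)
  open import Data.Product using (Σ; _×_; _,_)
  open import Relation.Binary.PropositionalEquality using (_≡_; _≢_; refl; sym; subst)
  open import Relation.Nullary using (yes; no)
  open Enumeration using (Sub124; triple; consIf; with4; extend)
  open Extension using (Sorted23; form23-pos; form23-1; linked-head; linked-cons)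

  split-min : ∀ k {xs} → Sorted23 xs → All (k ≤_) xs →
    Σ Bool λ b → Σ (List ℕ) λ xs′ → (xs ≡ consIf b k xs′) × Sorted23 xs′ × All (k <_) xs′
  split-min k {[]} s _ = false , [] , refl , s , []
  split-min k {x ∷ xs} (l , f ∷ fs) (k≤x ∷ _) with x ≟ k
  ... | yes refl = true , xs , refl , (Linked.tail l , fs) , linked-head l
  ... | no x≢k = false , x ∷ xs , refl , (l , f ∷ fs) , k<x ∷ All.map (<-trans k<x) (linked-head l)
    where k<x = ≤∧≢⇒< k≤x (λ k≡x → x≢k (sym k≡x))

  form23-div3 : ∀ {x} → Form23 x → 2 < x → x ≢ 4 → Σ ℕ λ y → (x ≡ 3 * y) × Form23 y
  form23-div3 (0 , 0 , _ , refl) (s≤s ()) _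
  form23-div3 (1 , 0 , _ , refl) (s≤s (s≤s ())) _
  form23-div3 (2 , 0 , _ , refl) _ 4≢4 = ⊥-elim (4≢4 refl)
  form23-div3 (suc (suc (suc _)) , 0 , s≤s (s≤s ()) , _) _ _
  form23-div3 (a , suc b , a≤2 , refl) _ _ = 2 ^ a * 3 ^ b , swap (2 ^ a) (3 ^ b) , (a , b , a≤2 , refl)
    where
    swap : ∀ p q → p * (3 * q) ≡ 3 * (p * q)
    swap = solve-∀

  triple-inverse : ∀ {zs} → All (λ z → 2 < z × z ≢ 4) zs → All Form23 zs →
    Σ (List ℕ) λ ys → (zs ≡ triple ys) × All Form23 ys
  triple-inverse [] [] = [] , refl , []
  triple-inverse ((z>2 , z≢4) ∷ zs-ok) (f ∷ fs) with form23-div3 f z>2 z≢4 | triple-inverse zs-ok fs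
  ... | y , refl , fy | ys , refl , fys = y ∷ ys , refl , fy ∷ fys

  triple-linked⁻ : ∀ {ys} → Linked _<_ (triple ys) → Linked _<_ ys
  triple-linked⁻ l = Linked.map (*-cancelˡ-< 3 _ _) (map⁻ l)

  4<⇒ : ∀ {z} → 4 < z → 2 < z × z ≢ 4
  4<⇒ 4<z = <-trans (s≤s (s≤s (s≤s z≤n))) 4<z , λ { refl → <-irrefl refl 4<z }

  triple-above⁻ : ∀ {ys} → All (4 <_) (triple ys) → All (1 <_) ys
  triple-above⁻ {[]} [] = []
  triple-above⁻ {y ∷ ys} (4<3y ∷ rest) = *-cancelˡ-< 3 1 y (<-trans 3<4 4<3y) ∷ triple-above⁻ rest
    where
    3<4 : 3 < 4
    3<4 = s≤s (s≤s (s≤s (s≤s z≤n)))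

  with4-true : ∀ {ys} → All (1 <_) ys → with4 true ys ≡ 4 ∷ triple ys
  with4-true {[]} _ = refl
  with4-true {suc (suc _) ∷ _} _ = refl
  with4-true {0 ∷ _} (() ∷ _)
  with4-true {1 ∷ _} (s≤s () ∷ _)

  above4-inverse : ∀ {zs} → Linked _<_ zs → All (4 <_) zs → All Form23 zs →
    Σ (List ℕ) λ ys → (zs ≡ triple ys) × Sorted23 ys × All (1 <_) ys
  above4-inverse l zs>4 fs with triple-inverse (All.map 4<⇒ zs>4) fs
  ... | ys , refl , fys = ys , refl , (triple-linked⁻ l , fys) , triple-above⁻ zs>4

  without4 : ∀ {zs} → All (λ z → 2 < z × z ≢ 4) zs → Linked _<_ zs → All Form23 zs →
    Σ (List ℕ) λ ys → (zs ≡ with4 false ys) × Sorted23 ys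
  without4 zs-ok l fs with triple-inverse zs-ok fs
  ... | ys , eq , fys = ys , eq , (triple-linked⁻ (subst (Linked _<_) eq l) , fys)

  with4-inverse : ∀ {xs} → Sorted23 xs → All (2 <_) xs →
    Σ Bool λ b → Σ (List ℕ) λ ys → (xs ≡ with4 b ys) × Sorted23 ys
  with4-inverse {[]} _ _ = false , [] , refl , (Linked.[] , [])
  with4-inverse {x ∷ xs} (l , _ ∷ fs) (x>2 ∷ _) with x ≟ 4
  ... | yes refl with above4-inverse (Linked.tail l) (linked-head l) fs
  ...   | ys , refl , sorted-ys , ys>1 = true , ys , sym (with4-true ys>1) , sorted-ys
  with4-inverse {x ∷ []} (l , fs) (x>2 ∷ _) | no x≢4 = false , without4 ((x>2 , x≢4) ∷ []) l fs
  with4-inverse {x ∷ z ∷ xs} (l , _ ∷ _ ∷ fs) (x>2 ∷ _) | no x≢4 with z ≟ 4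
  ... | yes refl with ≤-antisym (≤-pred (Linked.head l)) x>2
  ...   | refl with above4-inverse (Linked.tail (Linked.tail l)) (linked-head (Linked.tail l)) fs
  ...     | ys , refl , (l-ys , f-ys) , ys>1 = true , 1 ∷ ys , refl , (linked-cons ys>1 l-ys , form23-1 ∷ f-ys)
  with4-inverse {x ∷ z ∷ xs} (l , fs) (x>2 ∷ _) | no x≢4 | no z≢4 =
    false , without4 ((x>2 , x≢4) ∷ All.map 4<⇒ (z>4 ∷ All.map (<-trans z>4) (linked-head (Linked.tail l)))) l fs
    where
    z>4 : 4 < z
    z>4 = ≤∧≢⇒< (≤-<-trans x>2 (Linked.head l)) (λ 4≡z → z≢4 (sym 4≡z))

  extend-inverse : ∀ {xs} → Sorted23 xs → Σ Sub124 λ S → Σ (List ℕ) λ ys → (xs ≡ extend S ys) × Sorted23 ys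
  extend-inverse s@(_ , fs) with split-min 1 s (All.map form23-pos fs)
  ... | b₁ , xs₁ , refl , s₁ , xs₁>1 with split-min 2 s₁ xs₁>1
  ...   | b₂ , xs₂ , refl , s₂ , xs₂>2 with with4-inverse s₂ xs₂>2
  ...     | b₄ , ys , refl , sorted-ys = (b₁ , b₂ , b₄) , ys , refl , sorted-ys

module Bound where

  open import Defs using (sumRecip)
  open import Data.Bool using (true; false)
  open import Data.Empty using (⊥-elim)
  open import Data.Integer using (+_)
  open import Data.List using ([]; _∷_)
  open import Data.List.Relation.Unary.All using (_∷_)
  open import Data.Nat as ℕ using (ℕ; zero; suc; _+_; _*_; _≤_; _<_; z≤n)
  open import Data.Nat.ListAction using (sum)
  import Data.Nat.Properties as ℕ
  open import Data.Nat.Tactic.RingSolver using (solve-∀)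
  open import Data.Product using (_,_)
  open import Data.Rational as ℚ using (ℚ; 0ℚ; fromℚᵘ)
  import Data.Rational.Properties as ℚ
  open import Data.Rational.Unnormalised using (mkℚᵘ)
  open import Relation.Binary.PropositionalEquality using (_≡_; refl; sym; trans; cong; subst)
  open import Relation.Nullary using (¬_; yes; no)
  open import Relation.Nullary.Decidable using (toWitness; toWitnessFalse)
  open Enumeration
  open Quarters
  open Extension using (Sorted23; form23-pos; sumRecip-extend)
  open Decomposition using (extend-inverse)

  sum-triple : ∀ ys → sum (triple ys) ≡ 3 * sum ys
  sum-triple [] = refl
  sum-triple (y ∷ ys) = trans (cong (λ s → 3 * y + s) (sum-triple ys)) (sym (ℕ.*-distribˡ-+ 3 y (sum ys)))

  sum-with4-true : ∀ ys → sum (with4 true ys) ≡ 4 + sum (triple ys)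
  sum-with4-true [] = refl
  sum-with4-true (0 ∷ ys) = refl
  sum-with4-true (1 ∷ ys) = refl
  sum-with4-true (suc (suc y) ∷ ys) = refl

  sum-with4 : ∀ b ys → 3 * sum ys ≤ sum (with4 b ys)
  sum-with4 false ys = ℕ.≤-reflexive (sym (sum-triple ys))
  sum-with4 true ys = begin
    3 * sum ys             ≡⟨ sum-triple ys ⟨
    sum (triple ys)        ≤⟨ ℕ.m≤n+m _ 4 ⟩
    4 + sum (triple ys)    ≡⟨ sum-with4-true ys ⟨
    sum (with4 true ys)    ∎
    where open ℕ.≤-Reasoning

  sum-consIf : ∀ b x zs → sum zs ≤ sum (consIf b x zs)
  sum-consIf true x zs = ℕ.m≤n+m _ x
  sum-consIf false x zs = ℕ.≤-refl

  sum-extend : ∀ S ys → 3 * sum ys ≤ sum (extend S ys)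
  sum-extend (b₁ , b₂ , b₄) ys =
    ℕ.≤-trans (sum-with4 b₄ ys) (ℕ.≤-trans (sum-consIf b₂ 2 _) (sum-consIf b₁ 1 _))

  3*≤1+⇒≤ : ∀ s F → 3 * s ≤ suc F → s ≤ F
  3*≤1+⇒≤ zero F _ = z≤n
  3*≤1+⇒≤ (suc s) F 3s≤1+F =
    ℕ.≤-pred (ℕ.≤-trans (ℕ.m≤m+n (suc (suc s)) (1 + 2 * s)) (ℕ.≤-trans (ℕ.≤-reflexive (expand s)) 3s≤1+F))
    where
    expand : ∀ s → 2 + s + (1 + 2 * s) ≡ 3 * suc s
    expand = solve-∀

  sum-pos : ∀ {x xs} → Sorted23 (x ∷ xs) → 0 < sum (x ∷ xs)
  sum-pos (_ , fx ∷ _) = ℕ.≤-trans (form23-pos fx) (ℕ.m≤m+n _ _)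

  -- (7/4) · (1 + 1/3 + 1/9 + ⋯)
  maxSum : ℚ
  maxSum = fromℚᵘ (mkℚᵘ (+ 21) 7)

  weight≤7 : ∀ S → weight S ≤ 7
  weight≤7 (b₁ , b₂ , b₄) = ℕ.+-mono-≤ (ℕ.+-mono-≤ (ℕ.*-monoʳ-≤ 4 (≤1 b₁)) (ℕ.*-monoʳ-≤ 2 (≤1 b₂))) (≤1 b₄)
    where
    ≤1 : ∀ b → count𝔹 b ≤ 1
    ≤1 true = ℕ.≤-refl
    ≤1 false = z≤n

  sumRecip-bounded : ∀ F xs → sum xs ≤ F → Sorted23 xs → sumRecip xs ℚ.≤ maxSum
  sumRecip-bounded F [] _ _ = toWitness {a? = 0ℚ ℚ.≤? maxSum} _
  sumRecip-bounded zero (x ∷ xs) sum≤0 s = ⊥-elim (ℕ.<-irrefl refl (ℕ.<-≤-trans (sum-pos s) sum≤0))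
  sumRecip-bounded (suc F) xs@(_ ∷ _) sum≤F s with extend-inverse s
  ... | S , ys , xs≡ , sorted-ys = subst (λ zs → sumRecip zs ℚ.≤ maxSum) (sym xs≡) (begin
    sumRecip (extend S ys)                 ≡⟨ sumRecip-extend S ys ⟩
    quarter (weight S) ℚ.+ sumRecip ys ℚ.* ⅓
      ≤⟨ ℚ.+-mono-≤ (quarter-mono-≤ (weight≤7 S)) (ℚ.*-monoʳ-≤-nonNeg ⅓ (sumRecip-bounded F ys fuel sorted-ys)) ⟩
    quarter 7 ℚ.+ maxSum ℚ.* ⅓             ≡⟨⟩
    maxSum                                 ∎)
    where
    open ℚ.≤-Reasoning
    fuel = 3*≤1+⇒≤ (sum ys) F (ℕ.≤-trans (sum-extend S ys) (subst (λ zs → sum zs ≤ suc F) xs≡ sum≤F))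

  quarter-3*-bounded : ∀ {d ys} → Sorted23 ys → sumRecip ys ≡ quarter (3 * d) → d ≤ 3
  quarter-3*-bounded {d} {ys} s sumeq with d ℕ.≤? 3
  ... | yes d≤3 = d≤3
  ... | no d≰3 = ⊥-elim (quarter12≰maxSum (begin
    quarter 12                 ≤⟨ quarter-mono-≤ (ℕ.*-monoʳ-≤ 3 (ℕ.≰⇒> d≰3)) ⟩
    quarter (3 * d)            ≡⟨ sumeq ⟨
    sumRecip ys                ≤⟨ sumRecip-bounded (sum ys) ys ℕ.≤-refl s ⟩
    maxSum                     ∎))
    where
    open ℚ.≤-Reasoning
    quarter12≰maxSum : ¬ (quarter 12 ℚ.≤ maxSum)
    quarter12≰maxSum = toWitnessFalse {a? = quarter 12 ℚ.≤? maxSum} _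

module Completeness where

  open import Defs using (sumRecip)
  open import Data.Bool using (true; false)
  open import Data.Empty using (⊥-elim)
  open import Data.List using (List; []; _∷_; length)
  open import Data.List.Membership.Propositional using (_∈_)
  open import Data.List.Membership.Propositional.Properties using (∈-map⁺; ∈-++⁺ˡ; ∈-++⁺ʳ)
  open import Data.List.Relation.Unary.All using (_∷_)
  open import Data.List.Relation.Unary.Any using (here; there)
  open import Data.Nat as ℕ using (ℕ; zero; suc; _+_; _*_; _∸_; _^_; _≤_; z≤n)
  open import Data.Nat.ListAction using (sum)
  import Data.Nat.Properties as ℕ
  open import Data.Nat.Tactic.RingSolver using (solve-∀)
  open import Data.Product using (_,_)
  open import Data.Rational as ℚ using (0ℚ)
  import Data.Rational.Properties as ℚ
  open import Relation.Binary.PropositionalEquality using (_≡_; refl; sym; trans; cong; subst)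
  open Enumeration
  open Quarters
  open Extension using (Sorted23; form23-pos; sumRecip-extend; length-extend)
  open Soundness using (⇒fits)
  open Decomposition using (extend-inverse)
  open Bound using (sum-pos; sum-extend; 3*≤1+⇒≤; quarter-3*-bounded)

  sorted23-sumRecip-pos : ∀ {x xs} → Sorted23 (x ∷ xs) → 0ℚ ℚ.< sumRecip (x ∷ xs)
  sorted23-sumRecip-pos {suc k} {xs} _ = sumRecip-pos k xs
  sorted23-sumRecip-pos {zero} (_ , f ∷ _) with form23-pos f
  ... | ()

  sub124s-complete : ∀ S → S ∈ sub124s
  sub124s-complete (false , false , false) = here refl
  sub124s-complete (false , false , true) = there (here refl)
  sub124s-complete (false , true , false) = there (there (here refl))
  sub124s-complete (false , true , true) = there (there (there (here refl)))
  sub124s-complete (true , false , false) = there (there (there (there (here refl))))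
  sub124s-complete (true , false , true) = there (there (there (there (there (here refl)))))
  sub124s-complete (true , true , false) = there (there (there (there (there (there (here refl))))))
  sub124s-complete (true , true , true) = there (there (there (there (there (there (there (here refl)))))))

  module _ {prev : ℕ → ℕ → List (List ℕ)} {f t : ℕ} where

    ∈-branches : ∀ {S Ss xs} → S ∈ Ss → xs ∈ branch prev f t S → xs ∈ branches prev f t Ss
    ∈-branches (here refl) xs∈ = ∈-++⁺ˡ xs∈
    ∈-branches {Ss = S′ ∷ _} (there S∈) xs∈ = ∈-++⁺ʳ (branch prev f t S′) (∈-branches S∈ xs∈)

    ∈-branch : ∀ S {ys} → fits S t ≡ true → ys ∈ rest prev f (size S) (3 * (t ∸ weight S)) →
               extend S ys ∈ branch prev f t S
    ∈-branch S fits-S ys∈ with fits S t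
    ∈-branch S refl ys∈ | true = ∈-map⁺ (extend S) ys∈

  sets∸-+ : ∀ p m t → sets∸ (p + m) p t ≡ sets m t
  sets∸-+ zero m t = refl
  sets∸-+ (suc p) m t = sets∸-+ p m t

  ∈-sets∸ : ∀ {p m n t ys} → p + m ≡ n → ys ∈ sets m t → ys ∈ sets∸ n p t
  ∈-sets∸ {p} {m} {t = t} refl ys∈ = subst (_ ∈_) (sym (sets∸-+ p m t)) ys∈

  -- F bounds sum xs and decreases along X ↦ Y; in level-complete, 4 ≤ t · 3 ^ f guarantees that the fuel f
  -- does not run out before a step with S ≠ ∅.
  mutual
    sets-complete : ∀ F n t xs → sum xs ≤ F → Sorted23 xs → length xs ≡ n → sumRecip xs ≡ quarter t →
                    xs ∈ sets n t
    sets-complete F zero t [] _ _ _ sumeq with quarter-cancel-≤ {t} {0} (ℚ.≤-reflexive (sym sumeq))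
    ... | z≤n = here refl
    sets-complete F (suc n) zero (x ∷ xs) _ s _ sumeq = ⊥-elim (ℚ.<-irrefl (sym sumeq) (sorted23-sumRecip-pos s))
    sets-complete F (suc n) (suc t) xs sum≤F s len sumeq =
      level-complete F n 2 (suc t) xs sum≤F s len sumeq (ℕ.≤-trans (ℕ.m≤m+n 4 5) (ℕ.m≤m+n 9 (t * 9)))

    level-complete : ∀ F n f t xs → sum xs ≤ F → Sorted23 xs → length xs ≡ suc n → sumRecip xs ≡ quarter t →
                     4 ≤ t * 3 ^ f → xs ∈ level (sets∸ n) f t
    level-complete F n f zero xs _ _ _ _ ()
    level-complete zero n f (suc t) (x ∷ xs) sum≤0 s _ _ _ = ⊥-elim (ℕ.<-irrefl refl (ℕ.<-≤-trans (sum-pos s) sum≤0))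
    level-complete (suc F) n f (suc t) xs sum≤F s len sumeq fuelled with extend-inverse s
    ... | S , ys , xs≡ , sorted-ys = subst (_∈ level (sets∸ n) f (suc t)) (sym xs≡)
      (∈-branches (sub124s-complete S) (∈-branch S (⇒fits S (suc t) w≤t d≤3)
        (rest-complete F n f S (suc t) ys fuel sorted-ys length-ys sum-ys d≤3 fuelled)))
      where
      split : quarter (weight S) ℚ.+ sumRecip ys ℚ.* ⅓ ≡ quarter (suc t)
      split = trans (sym (sumRecip-extend S ys)) (trans (cong sumRecip (sym xs≡)) sumeq)
      w≤t = quarter-+-⅓⇒≤ (sumRecip-nonNeg ys) split
      sum-ys = quarter-+-⅓⇒≡ w≤t split
      d≤3 = quarter-3*-bounded sorted-ys sum-ys
      fuel = 3*≤1+⇒≤ (sum ys) F (ℕ.≤-trans (sum-extend S ys) (subst (λ zs → sum zs ≤ suc F) xs≡ sum≤F))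
      length-ys = trans (sym (length-extend S ys)) (trans (cong length (sym xs≡)) len)

    rest-complete : ∀ F n f S t ys → sum ys ≤ F → Sorted23 ys → size S + length ys ≡ suc n →
                    sumRecip ys ≡ quarter (3 * (t ∸ weight S)) → t ∸ weight S ≤ 3 → 4 ≤ t * 3 ^ f →
                    ys ∈ rest (sets∸ n) f (size S) (3 * (t ∸ weight S))
    rest-complete F n f (true , _ , _) t ys sum≤F s len sumeq _ _ =
      ∈-sets∸ (ℕ.suc-injective len) (sets-complete F _ _ ys sum≤F s refl sumeq)
    rest-complete F n f (false , true , _) t ys sum≤F s len sumeq _ _ =
      ∈-sets∸ (ℕ.suc-injective len) (sets-complete F _ _ ys sum≤F s refl sumeq)
    rest-complete F n f (false , false , true) t ys sum≤F s len sumeq _ _ =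
      ∈-sets∸ (ℕ.suc-injective len) (sets-complete F _ _ ys sum≤F s refl sumeq)
    rest-complete F n zero (false , false , false) t ys _ _ _ _ t≤3 fuelled =
      ⊥-elim (ℕ.<-irrefl refl (ℕ.≤-trans (ℕ.≤-trans fuelled (ℕ.≤-reflexive (ℕ.*-identityʳ t))) t≤3))
    rest-complete F n (suc f) (false , false , false) t ys sum≤F s len sumeq _ fuelled =
      level-complete F n f (3 * t) ys sum≤F s len sumeq (ℕ.≤-trans fuelled (ℕ.≤-reflexive (regroup t (3 ^ f))))
      where
      regroup : ∀ t e → t * (3 * e) ≡ 3 * t * e
      regroup = solve-∀

open import Defs
open import Data.Nat using (ℕ; _≤_)
open import Data.Nat.ListAction using (sum)
open import Data.Nat.Properties using (≤-refl; +-identityʳ)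
open import Data.List using (List; length)
open import Data.List.Membership.Propositional using (_∈_)
open import Data.List.Relation.Unary.All as All using ()
open import Data.List.Relation.Unary.Unique.Propositional using (Unique)
open import Data.Product using (Σ; _×_; _,_)
open import Function.Bundles using (_⇔_; mk⇔)
open import Relation.Binary.PropositionalEquality using (_≡_; sym; trans)
open Solution using (solution; solution-isSolution; solution-unique)
open Enumeration using (sets; sets∸-unique; length-sets)
open Counting using (total≡count)
open Extension using (form23-pos)
open Soundness using (sets∸-sound)
open Completeness using (sets-complete)

∈sets⇒admissible : ∀ n xs → xs ∈ sets n 4 → Admissible n xs
∈sets⇒admissible n xs xs∈ with sets∸-sound n 0 4 xs xs∈
... | len , (linked , form23) , sumeq =
  trans (sym (+-identityʳ _)) len , linked , All.map form23-pos form23 , form23 , sumeq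

admissible⇒∈sets : ∀ n xs → Admissible n xs → xs ∈ sets n 4
admissible⇒∈sets n xs (len , linked , _ , form23 , sumeq) =
  sets-complete (sum xs) n 4 xs ≤-refl (linked , form23) len sumeq

proposition4 : Σ Seqs λ s → IsSolution s
    × (∀ s' → IsSolution s' → SameOn≥3 s s')
    × (∀ n → 3 ≤ n → Σ (List (List ℕ)) λ L →
         Unique L × (∀ xs → (xs ∈ L) ⇔ Admissible n xs) × (length L ≡ total s n))
proposition4 = solution , solution-isSolution , solution-unique , λ n 3≤n →
  sets n 4 , sets∸-unique n 0 4 , (λ xs → mk⇔ (∈sets⇒admissible n xs) (admissible⇒∈sets n xs)) ,
  trans (length-sets n 4) (sym (total≡count n 3≤n))
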